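{- Let $1\leqslant k<n$ be integers and let $\mathbb{Z}\Delta=\{x=(x_1,\ldots,x_n)^\top\in\mathbb{Z}^n : k \text{ divides } x_1+\cdots+x_n\}$. An element $x\in\mathbb{Z}\Delta$ is a positive real root of $\mathsf{J}_{k,n}$ of degree $\geqslant 1$ if and only if (1) $0\leqslant x_i\leqslant \deg(x)$ for all $i=1,\ldots,n$; (2) $q(x)=2$; (3) repeated application of the map $x\longmapsto s_\beta(\mathrm{dec}(x))$ preserves property (1) until it changes the sign of all entries of $x$; that is, for the sequence $x^{(0)}=x$, $x^{(i+1)}=s_\beta(\mathrm{dec}(x^{(i)}))$, there is $m\geqslant 0$ such that each of $x^{(0)},\ldots,x^{(m)}$ satisfies property (1) (with respect to its own degree), and all entries of $x^{(m+1)}$ are non-positive.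
   Context: Let $e_1,\ldots,e_n$ be the standard basis of $\mathbb{Z}^n$. Simple roots: $\alpha_i=e_{i+1}-e_i$ for $i=1,\ldots,n-1$ and $\beta=e_1+\cdots+e_k$; they form a $\mathbb{Z}$-basis of $\mathbb{Z}\Delta$. The quadratic form is $q(x)=\sum_{i=1}^n x_i^2+\frac{2-k}{k^2}\big(\sum_{i=1}^n x_i\big)^2$, with inner product $(x,y)=\frac12(q(x+y)-q(x)-q(y))$; its Gram matrix on $\beta,\alpha_1,\ldots,\alpha_{n-1}$ is the generalized Cartan matrix of the tree $\mathsf{J}_{k,n}=\mathsf{T}_{2,k,n-k-2}$ (a path $\alpha_1-\cdots-\alpha_{n-1}$ with $\beta$ attached to $\alpha_k$). The degree of $x\in\mathbb{Z}\Delta$ is the coefficient of $\beta$ when $x$ is written in the basis $\beta,\alpha_1,\ldots,\alpha_{n-1}$; equivalently $\deg(x)=(x_1+\cdots+x_n)/k$. For $i=1,\ldots,n-1$, $s_i$ swaps the $i$-th and $(i+1)$-st coordinates; $s_\beta(x)=(x_1+r,\ldots,x_k+r,x_{k+1},\ldots,x_n)^\top$ with $r=x_{k+1}+\cdots+x_n-2\deg(x)$. The Weyl group $W=W(\mathsf{J}_{k,n})$ is the group generated by $s_\beta,s_1,\ldots,s_{n-1}$ acting on $\mathbb{Z}\Delta$. The real roots are the elements of $W\beta$; a root is positive if all its coefficients in the basis $\beta,\alpha_1,\ldots,\alpha_{n-1}$ are non-negative. For $x\in\mathbb{Z}\Delta$, $\mathrm{dec}(x)$ denotes the vector obtained by permuting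 the entries of $x$ into weakly decreasing order. -}

module Defs where

open import Data.Nat as ℕ using (ℕ; zero; suc; _<ᵇ_; _≡ᵇ_)
open import Data.Integer as ℤ using (ℤ; +_; _+_; _-_; _*_; _≤_; _≤?_; 0ℤ; 1ℤ)
open import Data.Integer.DivMod using (_/ℕ_)
open import Data.Integer.Divisibility using (_∣_)
open import Data.Vec as V using (Vec; []; _∷_; foldr; tabulate; replicate; zipWith)
open import Data.Vec.Relation.Unary.All using (All)
open import Data.Fin using (Fin; toℕ)
open import Data.Bool using (if_then_else_)
open import Data.Product using (Σ; ∃; ∃-syntax; _×_)
open import Data.List as L using (List)
open import Relation.Binary.PropositionalEquality using (_≡_)
open import Relation.Nullary using (yes; no)

-- Vectors in ℤ^n; position j (0-based) holds the coordinate x_{j+1}.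

sumℤ : ∀ {m} → Vec ℤ m → ℤ
sumℤ = foldr _ _+_ 0ℤ

InZΔ : (k : ℕ) → ∀ {n} → Vec ℤ n → Set
InZΔ k x = (+ k) ∣ sumℤ x

-- degree deg(x) = (x₁ + ⋯ + xₙ)/k  (exact on ℤΔ; k = 0 excluded by hypotheses)
deg : (k : ℕ) → ∀ {n} → Vec ℤ n → ℤ
deg zero    x = 0ℤ
deg (suc k) x = sumℤ x /ℕ suc k

-- q(x) = Σ xᵢ² + (2-k)/k² (Σ xᵢ)², written on ℤΔ as Σ xᵢ² + (2-k)·deg(x)²
q : (k : ℕ) → ∀ {n} → Vec ℤ n → ℤ
q k x = sumℤ (V.map (λ a → a * a) x) + (+ 2 - + k) * (deg k x * deg k x)

_·v_ : ∀ {m} → ℤ → Vec ℤ m → Vec ℤ m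
c ·v v = V.map (c *_) v

_⊕_ : ∀ {m} → Vec ℤ m → Vec ℤ m → Vec ℤ m
_⊕_ = zipWith _+_

betaV : (k n : ℕ) → Vec ℤ n
betaV k n = tabulate (λ j → if toℕ j <ᵇ k then 1ℤ else 0ℤ)

-- simple root αᵢ = e_{i+1} - eᵢ  (i is 1-based, 1 ≤ i ≤ n-1)
alphaV : (n i : ℕ) → Vec ℤ n
alphaV n i = tabulate (λ j → (if toℕ j ≡ᵇ i then 1ℤ else 0ℤ) - (if suc (toℕ j) ≡ᵇ i then 1ℤ else 0ℤ))

-- Σ_{j} c_j α_{i+1+j}
alphaComb : (n : ℕ) → ℕ → ∀ {m} → Vec ℤ m → Vec ℤ n
alphaComb n i []       = replicate n 0ℤ
alphaComb n i (c ∷ cs) = (c ·v alphaV n (suc i)) ⊕ alphaComb n (suc i) cs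

IsPositive : (k n : ℕ) → Vec ℤ n → Set
IsPositive k n x =
  Σ ℤ λ d → Σ (Vec ℤ (n ℕ.∸ 1)) λ c →
    (0ℤ ≤ d) × All (0ℤ ≤_) c × (x ≡ (d ·v betaV k n) ⊕ alphaComb n 0 c)

-- s_i (0-based here: swapAt i swaps positions i and i+1, i.e. coordinates i+1, i+2)
swapAt : ℕ → ∀ {m} → Vec ℤ m → Vec ℤ m
swapAt zero    (a ∷ b ∷ xs) = b ∷ a ∷ xs
swapAt zero    xs           = xs
swapAt (suc i) []           = []
swapAt (suc i) (a ∷ xs)     = a ∷ swapAt i xs

addFirst : ℕ → ℤ → ∀ {m} → Vec ℤ m → Vec ℤ m
addFirst zero    r xs       = xs
addFirst (suc j) r []       = []
addFirst (suc j) r (a ∷ xs) = (a + r) ∷ addFirst j r xs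

sumDrop : ℕ → ∀ {m} → Vec ℤ m → ℤ
sumDrop zero    xs       = sumℤ xs
sumDrop (suc j) []       = 0ℤ
sumDrop (suc j) (a ∷ xs) = sumDrop j xs

sβ : (k : ℕ) → ∀ {n} → Vec ℤ n → Vec ℤ n
sβ k x = addFirst k (sumDrop k x - (+ 2) * deg k x) x

data Gen (n : ℕ) : Set where
  genβ : Gen n
  genα : (i : ℕ) → suc i ℕ.< n → Gen n   -- s_{i+1} (0-based i)

act : (k : ℕ) → ∀ {n} → Gen n → Vec ℤ n → Vec ℤ n
act k genβ       x = sβ k x
act k (genα i _) x = swapAt i x

actWord : (k : ℕ) → ∀ {n} → List (Gen n) → Vec ℤ n → Vec ℤ n
actWord k L.[]       x = x
actWord k (g L.∷ gs) x = act k g (actWord k gs x)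

IsRealRoot : (k n : ℕ) → Vec ℤ n → Set
IsRealRoot k n x = ∃[ w ] actWord k w (betaV k n) ≡ x

insertDec : ℤ → ∀ {m} → Vec ℤ m → Vec ℤ (suc m)
insertDec a []       = a ∷ []
insertDec a (b ∷ xs) with b ≤? a
... | yes _ = a ∷ b ∷ xs
... | no  _ = b ∷ insertDec a xs

dec : ∀ {m} → Vec ℤ m → Vec ℤ m
dec []       = []
dec (a ∷ xs) = insertDec a (dec xs)

Prop1 : (k : ℕ) → ∀ {n} → Vec ℤ n → Set
Prop1 k x = All (λ a → (0ℤ ≤ a) × (a ≤ deg k x)) x

iter : (k : ℕ) → ∀ {n} → ℕ → Vec ℤ n → Vec ℤ n
iter k zero    x = x
iter k (suc i) x = sβ k (dec (iter k i x))

Prop3 : (k : ℕ) → ∀ {n} → Vec ℤ n → Set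
Prop3 k x = ∃[ m ] ((∀ i → i ℕ.≤ m → Prop1 k (iter k i x)) × All (_≤ 0ℤ) (iter k (suc m) x))

module Submission where

-- Pair each vector x with its degree d; on pairs with Σ x = k d the form of J_{k,n} is
-- integral. Call x a candidate if it satisfies (1)–(3). Every real root is a candidate,
-- the negative of one, or a vector eᵢ − eⱼ of degree 0, because this set contains β and is
-- closed under the sᵢ and under s_β. Closure under s_β is proved for the reflections s_A in
-- all permutations A of β at once, by induction on the degree. If (x, A) < 0 then x′ = s_A x
-- has larger degree, and its greedy step x′ ↦ s_β(dec x′) is the reflection s_B in another
-- permutation B of β. According to (A, B) ∈ {2, 1, 0, -1}, a dihedral relation writes s_B x′
-- as a word in s_A and s_B applied to x = s_A x′ whose intermediate vectors all have degree
-- below that of x′, so induction applies; the case (x, A) > 0 starts from the greedy step of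
-- x instead. Conversely, the greedy sequence of a candidate ends at a permutation of β, so
-- running it backwards exhibits x in W β, and 0 ≤ xᵢ ≤ deg x makes the α-coordinates of x
-- partial sums of non-negative terms.

open import Defs
open import Data.Nat as ℕ using (ℕ; zero; suc; z≤n; s≤s)
import Data.Nat.Properties as ℕP
open import Data.Integer as ℤ
  using (ℤ; +_; -[1+_]; _+_; _-_; _*_; -_; _≤_; _<_; _≤?_; 0ℤ; 1ℤ; +≤+; -≤+; -≤-; +<+)
import Data.Integer.Properties as ℤP
open import Data.Integer.DivMod using (_/ℕ_)
import Data.Integer.DivMod as DM
import Data.Integer.Divisibility.Signed as Signed
open import Data.Integer.Solver using (module +-*-Solver)
open import Data.Vec as V using (Vec; []; _∷_)
import Data.Vec.Properties as VecP
open import Data.Vec.Relation.Unary.All as All using (All; []; _∷_)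
import Data.Vec.Relation.Unary.All.Properties as AllP
import Data.Fin as Fin
open import Data.Product using (Σ; _×_; _,_; proj₁; proj₂)
open import Data.Product.Properties using () renaming (≡-dec to ×-≡-dec)
open import Data.Sum using (_⊎_; inj₁; inj₂)
open import Data.Unit using (⊤; tt)
open import Data.List as List using (List; []; _∷_; _++_)
open import Data.Empty using (⊥; ⊥-elim)
open import Relation.Binary.PropositionalEquality
  using (_≡_; _≢_; refl; sym; trans; cong; cong₂; subst; module ≡-Reasoning)
open import Relation.Binary.Definitions using (DecidableEquality; tri<; tri≈; tri>)
open import Relation.Nullary using (yes; no; ¬_)
open import Function.Bundles using (_⇔_; mk⇔)
open import Algebra.Properties.AbelianGroup ℤP.+-0-abelianGroup using () renaming (∙-cancelˡ to +-cancelˡ-≡)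

open +-*-Solver

-- Permutations and sorting

infix 4 _↭_

data _↭_ {A : Set} : ∀ {m} → Vec A m → Vec A m → Set where
  []     : [] ↭ []
  prep   : ∀ {m} {xs ys : Vec A m} a → xs ↭ ys → a ∷ xs ↭ a ∷ ys
  swap   : ∀ {m} {xs ys : Vec A m} a b → xs ↭ ys → a ∷ b ∷ xs ↭ b ∷ a ∷ ys
  ↭-trans : ∀ {m} {xs ys zs : Vec A m} → xs ↭ ys → ys ↭ zs → xs ↭ zs

module _ {A : Set} where

  ↭-refl : ∀ {m} (xs : Vec A m) → xs ↭ xs
  ↭-refl []       = []
  ↭-refl (a ∷ xs) = prep a (↭-refl xs)

  ↭-sym : ∀ {m} {xs ys : Vec A m} → xs ↭ ys → ys ↭ xs
  ↭-sym []            = []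
  ↭-sym (prep a p)    = prep a (↭-sym p)
  ↭-sym (swap a b p)  = swap b a (↭-sym p)
  ↭-sym (↭-trans p q) = ↭-trans (↭-sym q) (↭-sym p)

  ↭-map : ∀ {B : Set} (f : A → B) {m} {xs ys : Vec A m} → xs ↭ ys → V.map f xs ↭ V.map f ys
  ↭-map f []            = []
  ↭-map f (prep a p)    = prep (f a) (↭-map f p)
  ↭-map f (swap a b p)  = swap (f a) (f b) (↭-map f p)
  ↭-map f (↭-trans p q) = ↭-trans (↭-map f p) (↭-map f q)

  All-resp-↭ : ∀ {P : A → Set} {m} {xs ys : Vec A m} → xs ↭ ys → All P xs → All P ys
  All-resp-↭ []            []             = []
  All-resp-↭ (prep a p)    (pa ∷ ps)      = pa ∷ All-resp-↭ p ps
  All-resp-↭ (swap a b p)  (pa ∷ pb ∷ ps) = pb ∷ pa ∷ All-resp-↭ p ps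
  All-resp-↭ (↭-trans p q) ps             = All-resp-↭ q (All-resp-↭ p ps)

  ↭-zip : ∀ {B : Set} {m} {xs ys : Vec A m} → xs ↭ ys → (zs : Vec B m) →
          Σ (Vec B m) λ zs′ → V.zip xs zs ↭ V.zip ys zs′
  ↭-zip []           []           = [] , []
  ↭-zip (prep a p)   (c ∷ zs)     with ↭-zip p zs
  ... | zs′ , q = c ∷ zs′ , prep _ q
  ↭-zip (swap a b p) (c ∷ d ∷ zs) with ↭-zip p zs
  ... | zs′ , q = d ∷ c ∷ zs′ , swap _ _ q
  ↭-zip (↭-trans p q) zs with ↭-zip p zs
  ... | zs₁ , r with ↭-zip q zs₁
  ...   | zs₂ , s = zs₂ , ↭-trans r s

sumℤ-resp-↭ : ∀ {m} {xs ys : Vec ℤ m} → xs ↭ ys → sumℤ xs ≡ sumℤ ys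
sumℤ-resp-↭ []           = refl
sumℤ-resp-↭ (prep a p)   = cong (λ t → a + t) (sumℤ-resp-↭ p)
sumℤ-resp-↭ (swap {xs = xs} {ys} a b p) =
  trans (sym (ℤP.+-assoc a b (sumℤ xs)))
        (trans (cong₂ _+_ (ℤP.+-comm a b) (sumℤ-resp-↭ p)) (ℤP.+-assoc b a (sumℤ ys)))
sumℤ-resp-↭ (↭-trans p q) = trans (sumℤ-resp-↭ p) (sumℤ-resp-↭ q)

swapAt-↭ : ∀ i {m} (xs : Vec ℤ m) → swapAt i xs ↭ xs
swapAt-↭ zero    []           = []
swapAt-↭ zero    (a ∷ [])     = ↭-refl _
swapAt-↭ zero    (a ∷ b ∷ xs) = swap b a (↭-refl xs)
swapAt-↭ (suc i) []           = []
swapAt-↭ (suc i) (a ∷ xs)     = prep a (swapAt-↭ i xs)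

Swap : ℕ → Set
Swap m = Σ ℕ λ i → suc i ℕ.< m

applySwaps : ∀ {m} → List (Swap m) → Vec ℤ m → Vec ℤ m
applySwaps []            x = x
applySwaps ((i , _) ∷ ws) x = swapAt i (applySwaps ws x)

liftSwap : ∀ {m} → Swap m → Swap (suc m)
liftSwap (i , i<m) = suc i , s≤s i<m

applySwaps-lift : ∀ {m} (ws : List (Swap m)) (a : ℤ) (x : Vec ℤ m) →
                  applySwaps (List.map liftSwap ws) (a ∷ x) ≡ a ∷ applySwaps ws x
applySwaps-lift []             a x = refl
applySwaps-lift ((i , _) ∷ ws) a x = cong (swapAt (suc i)) (applySwaps-lift ws a x)

applySwaps-++ : ∀ {m} (ws vs : List (Swap m)) (x : Vec ℤ m) → applySwaps (ws ++ vs) x ≡ applySwaps ws (applySwaps vs x)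
applySwaps-++ []             vs x = refl
applySwaps-++ ((i , _) ∷ ws) vs x = cong (swapAt i) (applySwaps-++ ws vs x)

↭⇒swaps : ∀ {m} {xs ys : Vec ℤ m} → xs ↭ ys → Σ (List (Swap m)) λ ws → applySwaps ws xs ≡ ys
↭⇒swaps []         = [] , refl
↭⇒swaps (prep a p) with ↭⇒swaps p
... | ws , ws≡ = List.map liftSwap ws , trans (applySwaps-lift ws a _) (cong (a ∷_) ws≡)
↭⇒swaps (swap {xs = xs} a b p) with ↭⇒swaps p
... | ws , ws≡ = (0 , s≤s (s≤s z≤n)) ∷ List.map liftSwap (List.map liftSwap ws) ,
                 cong (swapAt 0) (trans (applySwaps-lift (List.map liftSwap ws) a (b ∷ xs))
                                   (cong (a ∷_) (trans (applySwaps-lift ws b xs) (cong (b ∷_) ws≡))))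
↭⇒swaps (↭-trans p q) with ↭⇒swaps p | ↭⇒swaps q
... | ws₁ , ws₁≡ | ws₂ , ws₂≡ =
  ws₂ ++ ws₁ , trans (applySwaps-++ ws₂ ws₁ _) (trans (cong (applySwaps ws₂) ws₁≡) ws₂≡)

≰⇒≥ : ∀ {a b : ℤ} → ¬ (a ≤ b) → b ≤ a
≰⇒≥ a≰b = ℤP.<⇒≤ (ℤP.≰⇒> a≰b)

insertDec-≤ : ∀ {a b} {m} (xs : Vec ℤ m) → b ≤ a → insertDec a (b ∷ xs) ≡ a ∷ b ∷ xs
insertDec-≤ {a} {b} xs b≤a with b ≤? a
... | yes _   = refl
... | no  b≰a = ⊥-elim (b≰a b≤a)

insertDec-≰ : ∀ {a b} {m} (xs : Vec ℤ m) → ¬ (b ≤ a) → insertDec a (b ∷ xs) ≡ b ∷ insertDec a xs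
insertDec-≰ {a} {b} xs b≰a with b ≤? a
... | yes b≤a = ⊥-elim (b≰a b≤a)
... | no  _   = refl

insertDec-↭ : ∀ a {m} (xs : Vec ℤ m) → insertDec a xs ↭ a ∷ xs
insertDec-↭ a []       = ↭-refl _
insertDec-↭ a (b ∷ xs) with b ≤? a
... | yes _ = ↭-refl _
... | no  _ = ↭-trans (prep b (insertDec-↭ a xs)) (swap b a (↭-refl xs))

dec-↭ : ∀ {m} (xs : Vec ℤ m) → dec xs ↭ xs
dec-↭ []       = []
dec-↭ (a ∷ xs) = ↭-trans (insertDec-↭ a (dec xs)) (prep a (dec-↭ xs))

insertDec-comm : ∀ a b {m} (xs : Vec ℤ m) →
                 insertDec a (insertDec b xs) ≡ insertDec b (insertDec a xs)
insertDec-comm a b [] with b ≤? a | a ≤? b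
... | yes b≤a | yes a≤b rewrite ℤP.≤-antisym b≤a a≤b = refl
... | yes _   | no  _   = refl
... | no  _   | yes _   = refl
... | no  b≰a | no  a≰b = ⊥-elim (b≰a (≰⇒≥ a≰b))
insertDec-comm a b (c ∷ xs) with c ≤? b | c ≤? a
... | yes c≤b | yes c≤a with b ≤? a | a ≤? b
...   | yes b≤a | yes a≤b rewrite ℤP.≤-antisym b≤a a≤b = refl
...   | yes _   | no  _   rewrite insertDec-≤ xs c≤b = refl
...   | no  _   | yes _   rewrite insertDec-≤ xs c≤a = refl
...   | no  b≰a | no  a≰b = ⊥-elim (b≰a (≰⇒≥ a≰b))
insertDec-comm a b (c ∷ xs) | yes c≤b | no c≰a
  rewrite insertDec-≰ (c ∷ xs) (λ b≤a → c≰a (ℤP.≤-trans c≤b b≤a))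
        | insertDec-≰ xs c≰a | insertDec-≤ (insertDec a xs) c≤b = refl
insertDec-comm a b (c ∷ xs) | no c≰b | yes c≤a
  rewrite insertDec-≰ (c ∷ xs) (λ a≤b → c≰b (ℤP.≤-trans c≤a a≤b))
        | insertDec-≰ xs c≰b | insertDec-≤ (insertDec b xs) c≤a = refl
insertDec-comm a b (c ∷ xs) | no c≰b | no c≰a
  rewrite insertDec-≰ (insertDec b xs) c≰a | insertDec-≰ (insertDec a xs) c≰b =
  cong (c ∷_) (insertDec-comm a b xs)

dec-resp-↭ : ∀ {m} {xs ys : Vec ℤ m} → xs ↭ ys → dec xs ≡ dec ys
dec-resp-↭ []            = refl
dec-resp-↭ (prep a p)    = cong (insertDec a) (dec-resp-↭ p)
dec-resp-↭ (swap {xs = xs} a b p) =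
  trans (insertDec-comm a b (dec xs)) (cong (λ t → insertDec b (insertDec a t)) (dec-resp-↭ p))
dec-resp-↭ (↭-trans p q) = trans (dec-resp-↭ p) (dec-resp-↭ q)

data Decreasing : ∀ {m} → Vec ℤ m → Set where
  []  : Decreasing []
  _∷_ : ∀ {m} {a} {xs : Vec ℤ m} → All (_≤ a) xs → Decreasing xs → Decreasing (a ∷ xs)

insertDec-decreasing : ∀ a {m} {xs : Vec ℤ m} → Decreasing xs → Decreasing (insertDec a xs)
insertDec-decreasing a {xs = []}     []         = [] ∷ []
insertDec-decreasing a {xs = b ∷ xs} (b≥ ∷ ds) with b ≤? a
... | yes b≤a = (b≤a ∷ All.map (λ c≤b → ℤP.≤-trans c≤b b≤a) b≥) ∷ b≥ ∷ ds
... | no  b≰a = All-resp-↭ (↭-sym (insertDec-↭ a xs)) (≰⇒≥ b≰a ∷ b≥) ∷ insertDec-decreasing a ds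

dec-decreasing : ∀ {m} (xs : Vec ℤ m) → Decreasing (dec xs)
dec-decreasing []       = []
dec-decreasing (a ∷ xs) = insertDec-decreasing a (dec-decreasing xs)

0≤i+j : ∀ {i j : ℤ} → 0ℤ ≤ i → 0ℤ ≤ j → 0ℤ ≤ i + j
0≤i+j = ℤP.+-mono-≤

0≤i*j : ∀ {i j : ℤ} → 0ℤ ≤ i → 0ℤ ≤ j → 0ℤ ≤ i * j
0≤i*j {+ i} {+ j} _ _ = subst (0ℤ ≤_) (ℤP.pos-* i j) (+≤+ z≤n)

0≤i*i : ∀ i → 0ℤ ≤ i * i
0≤i*i (+ i)      = 0≤i*j {+ i} {+ i} (+≤+ z≤n) (+≤+ z≤n)
0≤i*i (-[1+ i ]) = subst (0ℤ ≤_) (ℤP.pos-* (suc i) (suc i)) (+≤+ z≤n)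

0≤i*i-i : ∀ i → 0ℤ ≤ i * i - i
0≤i*i-i (+ zero)   = ℤP.≤-refl
0≤i*i-i (+ suc i)  = subst (0ℤ ≤_) (solve 1 (λ a → a :* (a :- con 1ℤ) := a :* a :- a) refl (+ suc i))
  (0≤i*j {+ suc i} (+≤+ z≤n) (ℤP.i≤j⇒0≤j-i {1ℤ} {+ suc i} (+≤+ (s≤s z≤n))))
0≤i*i-i (-[1+ i ]) = subst (0ℤ ≤_) (solve 1 (λ a → (:- a) :* (con 1ℤ :- a) := a :* a :- a) refl -[1+ i ])
  (0≤i*j { - -[1+ i ]} (+≤+ z≤n) (ℤP.i≤j⇒0≤j-i { -[1+ i ]} {1ℤ} -≤+))

0≤i*i+i : ∀ i → 0ℤ ≤ i * i + i
0≤i*i+i i = subst (0ℤ ≤_) (solve 1 (λ a → (:- a) :* (:- a) :- (:- a) := a :* a :+ a) refl i) (0≤i*i-i (- i))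

≤-witness : ∀ {i j : ℤ} (e : ℤ) → j - i ≡ e → 0ℤ ≤ e → i ≤ j
≤-witness e j-i≡e 0≤e = ℤP.0≤i-j⇒j≤i (subst (0ℤ ≤_) (sym j-i≡e) 0≤e)

1≤i+j : ∀ {i j : ℤ} → 1ℤ ≤ i → 1ℤ ≤ j → 1ℤ ≤ i + j
1≤i+j {i} 1≤i 1≤j = ℤP.≤-trans 1≤i (subst (_≤ i + _) (ℤP.+-identityʳ i) (ℤP.+-monoʳ-≤ i (ℤP.≤-trans (+≤+ z≤n) 1≤j)))

4≤i*i : ∀ i → (+ 2 ≤ i) ⊎ (i ≤ - + 2) → + 4 ≤ i * i
4≤i*i i (inj₁ 2≤i) =
  ≤-witness ((i - + 2) * (i + + 2)) (solve 1 (λ h → h :* h :- con (+ 4) := (h :- con (+ 2)) :* (h :+ con (+ 2))) refl i)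
    (0≤i*j (ℤP.i≤j⇒0≤j-i 2≤i) (ℤP.i≤j⇒0≤j-i { -[1+ 1 ]} (ℤP.≤-trans -≤+ 2≤i)))
4≤i*i i (inj₂ i≤-2) =
  ≤-witness ((+ 2 - i) * (- i - + 2)) (solve 1 (λ h → h :* h :- con (+ 4) := (con (+ 2) :- h) :* (:- h :- con (+ 2))) refl i)
    (0≤i*j (ℤP.i≤j⇒0≤j-i {i} {+ 2} (ℤP.≤-trans i≤-2 -≤+)) (ℤP.i≤j⇒0≤j-i {+ 2} (ℤP.neg-mono-≤ i≤-2)))

|i|≥2-square-contra : ∀ i t (j : ℕ) → j ℕ.≤ 3 → i * i + t ≡ + j → 0ℤ ≤ t → (+ 2 ≤ i) ⊎ (i ≤ - + 2) → ⊥
|i|≥2-square-contra i t j j≤3 eq 0≤t big =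
  ℤP.<-irrefl refl (ℤP.<-≤-trans (+<+ (s≤s j≤3))
    (subst (+ 4 ≤_) eq (subst (_≤ i * i + t) (ℤP.+-identityʳ (+ 4)) (ℤP.+-mono-≤ (4≤i*i i big) 0≤t))))

0≤i∧i*i≡1⇒i≡1 : ∀ i → 0ℤ ≤ i → i * i ≡ 1ℤ → i ≡ 1ℤ
0≤i∧i*i≡1⇒i≡1 (+ 0)           _ ()
0≤i∧i*i≡1⇒i≡1 (+ 1)           _ _   = refl
0≤i∧i*i≡1⇒i≡1 (+ suc (suc i)) _ eq =
  ⊥-elim (|i|≥2-square-contra (+ suc (suc i)) 0ℤ 1 (s≤s z≤n) (trans (ℤP.+-identityʳ _) eq) ℤP.≤-refl
           (inj₁ (+≤+ (s≤s (s≤s z≤n)))))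

between-±1 : ∀ t → - 1ℤ ≤ t → t ≤ 1ℤ → t ≡ 1ℤ ⊎ t ≡ 0ℤ ⊎ t ≡ - 1ℤ
between-±1 (+ 0)            _        _                  = inj₂ (inj₁ refl)
between-±1 (+ 1)            _        _                  = inj₁ refl
between-±1 (+ suc (suc _))  _        (+≤+ (s≤s ()))
between-±1 -[1+ 0 ]         _        _                  = inj₂ (inj₂ refl)
between-±1 -[1+ suc _ ]     (-≤- ()) _

≤2-cases : ∀ c → c ≤ + 2 → c ≡ + 2 ⊎ c ≡ 1ℤ ⊎ c ≡ 0ℤ ⊎ c ≡ - 1ℤ ⊎ c ≤ - + 2
≤2-cases (+ 0)                   _ = inj₂ (inj₂ (inj₁ refl))
≤2-cases (+ 1)                   _ = inj₂ (inj₁ refl)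
≤2-cases (+ 2)                   _ = inj₁ refl
≤2-cases (+ suc (suc (suc _)))   (+≤+ (s≤s (s≤s ())))
≤2-cases -[1+ 0 ]                _ = inj₂ (inj₂ (inj₂ (inj₁ refl)))
≤2-cases -[1+ suc _ ]            _ = inj₂ (inj₂ (inj₂ (inj₂ (-≤- (s≤s z≤n)))))

sumTake : ℕ → ∀ {m} → Vec ℤ m → ℤ
sumTake zero    xs       = 0ℤ
sumTake (suc j) []       = 0ℤ
sumTake (suc j) (a ∷ xs) = a + sumTake j xs

AllTake : (ℤ → Set) → ℕ → ∀ {m} → Vec ℤ m → Set
AllTake P zero    xs       = ⊤
AllTake P (suc j) []       = ⊤
AllTake P (suc j) (a ∷ xs) = P a × AllTake P j xs

AllDrop : (ℤ → Set) → ℕ → ∀ {m} → Vec ℤ m → Set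
AllDrop P zero    xs       = All P xs
AllDrop P (suc j) []       = ⊤
AllDrop P (suc j) (a ∷ xs) = AllDrop P j xs

module _ {P : ℤ → Set} where

  All⇒AllTake : ∀ j {m} {xs : Vec ℤ m} → All P xs → AllTake P j xs
  All⇒AllTake zero    ps       = tt
  All⇒AllTake (suc j) []       = tt
  All⇒AllTake (suc j) (p ∷ ps) = p , All⇒AllTake j ps

  All⇒AllDrop : ∀ j {m} {xs : Vec ℤ m} → All P xs → AllDrop P j xs
  All⇒AllDrop zero    ps       = ps
  All⇒AllDrop (suc j) []       = tt
  All⇒AllDrop (suc j) (p ∷ ps) = All⇒AllDrop j ps

  AllTake+AllDrop⇒All : ∀ j {m} (xs : Vec ℤ m) → AllTake P j xs → AllDrop P j xs → All P xs
  AllTake+AllDrop⇒All zero    xs       _        ds = ds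
  AllTake+AllDrop⇒All (suc j) []       _        _  = []
  AllTake+AllDrop⇒All (suc j) (a ∷ xs) (p , ts) ds = p ∷ AllTake+AllDrop⇒All j xs ts ds

module _ {P Q : ℤ → Set} where

  AllTake-map : (∀ {a} → P a → Q a) → ∀ j {m} (xs : Vec ℤ m) → AllTake P j xs → AllTake Q j xs
  AllTake-map f zero    xs       _        = tt
  AllTake-map f (suc j) []       _        = tt
  AllTake-map f (suc j) (a ∷ xs) (p , ts) = f p , AllTake-map f j xs ts

  AllDrop-map : (∀ {a} → P a → Q a) → ∀ j {m} (xs : Vec ℤ m) → AllDrop P j xs → AllDrop Q j xs
  AllDrop-map f zero    xs       ds = All.map f ds
  AllDrop-map f (suc j) []       _  = tt
  AllDrop-map f (suc j) (a ∷ xs) ds = AllDrop-map f j xs ds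

  AllTake-zip : ∀ j {m} (xs : Vec ℤ m) → AllTake P j xs → AllTake Q j xs → AllTake (λ a → P a × Q a) j xs
  AllTake-zip zero    xs       _        _        = tt
  AllTake-zip (suc j) []       _        _        = tt
  AllTake-zip (suc j) (a ∷ xs) (p , ps) (q , qs) = (p , q) , AllTake-zip j xs ps qs

  AllDrop-zip : ∀ j {m} (xs : Vec ℤ m) → AllDrop P j xs → AllDrop Q j xs → AllDrop (λ a → P a × Q a) j xs
  AllDrop-zip zero    xs       ps qs = All.zip (ps , qs)
  AllDrop-zip (suc j) []       _  _  = tt
  AllDrop-zip (suc j) (a ∷ xs) ps qs = AllDrop-zip j xs ps qs

module _ {P : ℤ → Set} where

  addFirst-All : ∀ j r {m} (xs : Vec ℤ m) →
                 AllTake (λ a → P (a + r)) j xs → AllDrop P j xs → All P (addFirst j r xs)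
  addFirst-All zero    r xs       _        ds = ds
  addFirst-All (suc j) r []       _        _  = []
  addFirst-All (suc j) r (a ∷ xs) (p , ts) ds = p ∷ addFirst-All j r xs ts ds

  All-addFirst⇒AllDrop : ∀ j r {m} (xs : Vec ℤ m) → All P (addFirst j r xs) → AllDrop P j xs
  All-addFirst⇒AllDrop zero    r xs       ps       = ps
  All-addFirst⇒AllDrop (suc j) r []       _        = tt
  All-addFirst⇒AllDrop (suc j) r (a ∷ xs) (_ ∷ ps) = All-addFirst⇒AllDrop j r xs ps

sumℤ-split : ∀ j {m} (xs : Vec ℤ m) → sumℤ xs ≡ sumTake j xs + sumDrop j xs
sumℤ-split zero    xs       = sym (ℤP.+-identityˡ _)
sumℤ-split (suc j) []       = refl
sumℤ-split (suc j) (a ∷ xs) = trans (cong (λ t → a + t) (sumℤ-split j xs)) (sym (ℤP.+-assoc a _ _))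

sumTake≤ : ∀ D j {m} (xs : Vec ℤ m) → AllTake (_≤ D) j xs → j ℕ.≤ m → sumTake j xs ≤ + j * D
sumTake≤ D zero    xs       _          _         = ℤP.≤-refl
sumTake≤ D (suc j) (a ∷ xs) (a≤D , ts) (s≤s j≤m) =
  subst (a + sumTake j xs ≤_) (solve 2 (λ D J → D :+ J :* D := (con 1ℤ :+ J) :* D) refl D (+ j))
    (ℤP.+-mono-≤ a≤D (sumTake≤ D j xs ts j≤m))

sumTake≡⇒AllTake≡ : ∀ D j {m} (xs : Vec ℤ m) → j ℕ.≤ m → AllTake (_≤ D) j xs →
                    sumTake j xs ≡ + j * D → AllTake (_≡ D) j xs
sumTake≡⇒AllTake≡ D zero    xs       _         _          _  = tt
sumTake≡⇒AllTake≡ D (suc j) (a ∷ xs) (s≤s j≤m) (a≤D , ts) eq = a≡D , sumTake≡⇒AllTake≡ D j xs j≤m ts H≡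
  where
  H = sumTake j xs
  a≡D : a ≡ D
  a≡D = ℤP.≤-antisym a≤D (≤-witness (+ j * D - H)
    (trans (solve 4 (λ a H D J → a :- D := (J :* D :- H) :+ (a :+ H :- (con 1ℤ :+ J) :* D)) refl a H D (+ j))
           (trans (cong (λ t → (+ j * D - H) + (t - (1ℤ + + j) * D)) eq)
                  (trans (cong (λ t → (+ j * D - H) + t) (ℤP.+-inverseʳ ((1ℤ + + j) * D))) (ℤP.+-identityʳ _))))
    (ℤP.i≤j⇒0≤j-i (sumTake≤ D j xs ts j≤m)))
  H≡ : H ≡ + j * D
  H≡ = trans (solve 2 (λ a H → H := a :+ H :- a) refl a H)
             (trans (cong₂ _-_ eq a≡D) (solve 2 (λ D J → (con 1ℤ :+ J) :* D :- D := J :* D) refl D (+ j)))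

squares : ∀ {m} → Vec ℤ m → Vec ℤ m
squares = V.map (λ a → a * a)

decreasing-split : ∀ j {m} (xs : Vec ℤ m) → Decreasing xs → suc j ℕ.≤ m →
                   Σ ℤ λ μ → AllTake (μ ≤_) (suc j) xs × AllDrop (_≤ μ) (suc j) xs
decreasing-split zero    (a ∷ xs)     (a≥ ∷ _)          _         = a , (ℤP.≤-refl , tt) , a≥
decreasing-split (suc j) (a ∷ b ∷ xs) ((b≤a ∷ _) ∷ ds) (s≤s j<m) with decreasing-split j (b ∷ xs) ds j<m
... | μ , (μ≤b , ts) , rest = μ , (ℤP.≤-trans μ≤b b≤a , μ≤b , ts) , rest

sumTake-squares≤ : ∀ (D μ : ℤ) j {m} (xs : Vec ℤ m) → j ℕ.≤ m → AllTake (λ a → (μ ≤ a) × (a ≤ D)) j xs →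
                   sumTake j (squares xs) + D * μ * + j ≤ (D + μ) * sumTake j xs
sumTake-squares≤ D μ zero xs _ _ =
  ℤP.≤-reflexive (solve 2 (λ D μ → con 0ℤ :+ D :* μ :* con 0ℤ := (D :+ μ) :* con 0ℤ) refl D μ)
sumTake-squares≤ D μ (suc j) (a ∷ xs) (s≤s j≤m) ((μ≤a , a≤D) , ts) =
  ≤-witness _ eq (0≤i+j (0≤i*j (ℤP.i≤j⇒0≤j-i a≤D) (ℤP.i≤j⇒0≤j-i μ≤a))
                       (ℤP.i≤j⇒0≤j-i (sumTake-squares≤ D μ j xs j≤m ts)))
  where
  S = sumTake j (squares xs)
  H = sumTake j xs
  eq : (D + μ) * (a + H) - (a * a + S + D * μ * + suc j)
       ≡ (D - a) * (a - μ) + ((D + μ) * H - (S + D * μ * + j))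
  eq = solve 6 (λ D μ a H S J → (D :+ μ) :* (a :+ H) :- (a :* a :+ S :+ D :* μ :* (con 1ℤ :+ J))
                 := (D :- a) :* (a :- μ) :+ ((D :+ μ) :* H :- (S :+ D :* μ :* J))) refl D μ a H S (+ j)

sumDrop-squares≤ : ∀ (μ : ℤ) j {m} (xs : Vec ℤ m) → AllDrop (λ a → (0ℤ ≤ a) × (a ≤ μ)) j xs →
                   sumDrop j (squares xs) ≤ μ * sumDrop j xs
sumDrop-squares≤ μ zero [] _ = ℤP.≤-reflexive (solve 1 (λ μ → con 0ℤ := μ :* con 0ℤ) refl μ)
sumDrop-squares≤ μ zero (a ∷ xs) ((0≤a , a≤μ) ∷ ds) =
  ≤-witness _ (solve 4 (λ μ a T S → μ :* (a :+ T) :- (a :* a :+ S) := a :* (μ :- a) :+ (μ :* T :- S))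
                       refl μ a (sumℤ xs) (sumℤ (squares xs)))
    (0≤i+j (0≤i*j 0≤a (ℤP.i≤j⇒0≤j-i a≤μ)) (ℤP.i≤j⇒0≤j-i (sumDrop-squares≤ μ zero xs ds)))
sumDrop-squares≤ μ (suc j) []       _  = ℤP.≤-reflexive (solve 1 (λ μ → con 0ℤ := μ :* con 0ℤ) refl μ)
sumDrop-squares≤ μ (suc j) (a ∷ xs) ds = sumDrop-squares≤ μ j xs ds

-- With μ = x_k: a² ≤ (D + μ) a − D μ on the first k entries and a² ≤ μ a on the others;
-- the μ-terms add up to μ (Σ x − k D) = 0.
sum-squares≤ : ∀ k D {m} (xs : Vec ℤ m) → Decreasing xs → All (λ a → (0ℤ ≤ a) × (a ≤ D)) xs →
               1 ℕ.≤ k → k ℕ.≤ m → sumℤ xs ≡ + k * D → sumℤ (squares xs) ≤ D * sumTake k xs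
sum-squares≤ (suc j) D xs ds bounds (s≤s z≤n) k≤m sum≡ with decreasing-split j xs ds k≤m
... | μ , top , bottom = ≤-witness _ eq (0≤i+j (ℤP.i≤j⇒0≤j-i topBound) (ℤP.i≤j⇒0≤j-i bottomBound))
  where
  topBound : sumTake (suc j) (squares xs) + D * μ * + suc j ≤ (D + μ) * sumTake (suc j) xs
  topBound = sumTake-squares≤ D μ (suc j) xs k≤m
    (AllTake-zip (suc j) xs top (All⇒AllTake (suc j) (All.map proj₂ bounds)))
  bottomBound : sumDrop (suc j) (squares xs) ≤ μ * sumDrop (suc j) xs
  bottomBound = sumDrop-squares≤ μ (suc j) xs
    (AllDrop-zip (suc j) xs (All⇒AllDrop (suc j) (All.map proj₁ bounds)) bottom)
  H  = sumTake (suc j) xs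
  T  = sumDrop (suc j) xs
  HS = sumTake (suc j) (squares xs)
  TS = sumDrop (suc j) (squares xs)
  K  = + suc j
  e  = ((D + μ) * H - (HS + D * μ * K)) + (μ * T - TS)
  H+T≡ : H + T ≡ K * D
  H+T≡ = trans (sym (sumℤ-split (suc j) xs)) sum≡
  eq : D * H - sumℤ (squares xs) ≡ e
  eq = begin
    D * H - sumℤ (squares xs)          ≡⟨ cong (λ t → D * H - t) (sumℤ-split (suc j) (squares xs)) ⟩
    D * H - (HS + TS)                  ≡⟨ solve 7 (λ D μ H T HS TS K → D :* H :- (HS :+ TS)
                                            := ((D :+ μ) :* H :- (HS :+ D :* μ :* K)) :+ (μ :* T :- TS)
                                               :+ μ :* (K :* D :- (H :+ T))) refl D μ H T HS TS K ⟩
    e + μ * (K * D - (H + T))          ≡⟨ cong (λ t → e + μ * (K * D - t)) H+T≡ ⟩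
    e + μ * (K * D - K * D)            ≡⟨ cong (λ t → e + μ * t) (ℤP.+-inverseʳ (K * D)) ⟩
    e + μ * 0ℤ                         ≡⟨ cong (λ t → e + t) (ℤP.*-zeroʳ μ) ⟩
    e + 0ℤ                             ≡⟨ ℤP.+-identityʳ e ⟩
    e                                  ∎
    where open ≡-Reasoning

dot : ∀ {m} → Vec ℤ m → Vec ℤ m → ℤ
dot []      []      = 0ℤ
dot (a ∷ x) (b ∷ y) = a * b + dot x y

subv : ℤ → ∀ {m} → Vec ℤ m → Vec ℤ m → Vec ℤ m
subv c []      []      = []
subv c (a ∷ x) (g ∷ y) = (a - c * g) ∷ subv c x y

dot-comm : ∀ {m} (x y : Vec ℤ m) → dot x y ≡ dot y x
dot-comm []      []      = refl
dot-comm (a ∷ x) (b ∷ y) = cong₂ _+_ (ℤP.*-comm a b) (dot-comm x y)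

dot-subv : ∀ c {m} (x g y : Vec ℤ m) → dot (subv c x g) y ≡ dot x y - c * dot g y
dot-subv c []      []       []      = solve 1 (λ c → con 0ℤ := con 0ℤ :- c :* con 0ℤ) refl c
dot-subv c (a ∷ x) (g ∷ gs) (b ∷ y) =
  trans (cong (λ t → (a - c * g) * b + t) (dot-subv c x gs y))
        (solve 6 (λ a c g b X G → (a :- c :* g) :* b :+ (X :- c :* G) := a :* b :+ X :- c :* (g :* b :+ G))
               refl a c g b (dot x y) (dot gs y))

dot-neg : ∀ {m} (x y : Vec ℤ m) → dot (V.map -_ x) y ≡ - dot x y
dot-neg []      []      = refl
dot-neg (a ∷ x) (b ∷ y) =
  trans (cong (λ t → - a * b + t) (dot-neg x y))
        (solve 3 (λ a b X → (:- a) :* b :+ (:- X) := :- (a :* b :+ X)) refl a b (dot x y))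

dot-self≡sum-squares : ∀ {m} (x : Vec ℤ m) → dot x x ≡ sumℤ (squares x)
dot-self≡sum-squares []      = refl
dot-self≡sum-squares (a ∷ x) = cong (λ t → a * a + t) (dot-self≡sum-squares x)

dot-self-nonneg : ∀ {m} (x : Vec ℤ m) → 0ℤ ≤ dot x x
dot-self-nonneg []      = ℤP.≤-refl
dot-self-nonneg (a ∷ x) = 0≤i+j (0≤i*i a) (dot-self-nonneg x)

dot-zeroʳ : ∀ {m} (x r : Vec ℤ m) → All (_≡ 0ℤ) r → dot x r ≡ 0ℤ
dot-zeroʳ []      []        []          = refl
dot-zeroʳ (a ∷ x) (.0ℤ ∷ r) (refl ∷ zs) =
  trans (cong (λ t → a * 0ℤ + t) (dot-zeroʳ x r zs)) (trans (ℤP.+-identityʳ _) (ℤP.*-zeroʳ a))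

subv-zeroʳ : ∀ c {m} (x r : Vec ℤ m) → All (_≡ 0ℤ) r → subv c x r ≡ x
subv-zeroʳ c []      []        []          = refl
subv-zeroʳ c (a ∷ x) (.0ℤ ∷ r) (refl ∷ zs) =
  cong₂ _∷_ (solve 2 (λ a c → a :- c :* con 0ℤ := a) refl a c) (subv-zeroʳ c x r zs)

subv-zeroˡ : ∀ {m} (x g : Vec ℤ m) → subv 0ℤ x g ≡ x
subv-zeroˡ []      []      = refl
subv-zeroˡ (a ∷ x) (g ∷ y) = cong₂ _∷_ (solve 2 (λ a g → a :- con 0ℤ :* g := a) refl a g) (subv-zeroˡ x y)

subv-subv : ∀ a b {m} (x g : Vec ℤ m) → subv a (subv b x g) g ≡ subv (b + a) x g
subv-subv a b []      []      = refl
subv-subv a b (x ∷ xs) (g ∷ gs) =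
  cong₂ _∷_ (solve 4 (λ x a b g → x :- b :* g :- a :* g := x :- (b :+ a) :* g) refl x a b g) (subv-subv a b xs gs)

subv-neg : ∀ c {m} (x g : Vec ℤ m) → subv c (V.map -_ x) g ≡ V.map -_ (subv (- c) x g)
subv-neg c []       []       = refl
subv-neg c (x ∷ xs) (g ∷ gs) =
  cong₂ _∷_ (solve 3 (λ x c g → :- x :- c :* g := :- (x :- (:- c) :* g)) refl x c g) (subv-neg c xs gs)

subv-self : ∀ {m} (x : Vec ℤ m) → subv (+ 2) x x ≡ V.map -_ x
subv-self []      = refl
subv-self (a ∷ x) = cong₂ _∷_ (solve 1 (λ a → a :- con (+ 2) :* a := :- a) refl a) (subv-self x)

map-neg-involutive : ∀ {m} (x : Vec ℤ m) → V.map -_ (V.map -_ x) ≡ x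
map-neg-involutive []      = refl
map-neg-involutive (a ∷ x) = cong₂ _∷_ (ℤP.neg-involutive a) (map-neg-involutive x)

sumℤ-subv : ∀ c {m} (x g : Vec ℤ m) → sumℤ (subv c x g) ≡ sumℤ x - c * sumℤ g
sumℤ-subv c []      []      = solve 1 (λ c → con 0ℤ := con 0ℤ :- c :* con 0ℤ) refl c
sumℤ-subv c (a ∷ x) (b ∷ g) =
  trans (cong (λ t → a - c * b + t) (sumℤ-subv c x g))
        (solve 5 (λ a c b X G → a :- c :* b :+ (X :- c :* G) := a :+ X :- c :* (b :+ G)) refl a c b (sumℤ x) (sumℤ g))

sumℤ-neg : ∀ {m} (x : Vec ℤ m) → sumℤ (V.map -_ x) ≡ - sumℤ x
sumℤ-neg []      = refl
sumℤ-neg (a ∷ x) = trans (cong (λ t → - a + t) (sumℤ-neg x)) (sym (ℤP.neg-distrib-+ a (sumℤ x)))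

sumℤ-zeros : ∀ {m} (r : Vec ℤ m) → All (_≡ 0ℤ) r → sumℤ r ≡ 0ℤ
sumℤ-zeros []        []          = refl
sumℤ-zeros (.0ℤ ∷ r) (refl ∷ zs) = trans (ℤP.+-identityˡ _) (sumℤ-zeros r zs)

sumDrop-zeros : ∀ j {m} (z : Vec ℤ m) → AllDrop (_≡ 0ℤ) j z → sumDrop j z ≡ 0ℤ
sumDrop-zeros zero    z       zs = sumℤ-zeros z zs
sumDrop-zeros (suc j) []      _  = refl
sumDrop-zeros (suc j) (a ∷ z) zs = sumDrop-zeros j z zs

sumℤ-nonneg : ∀ {m} (v : Vec ℤ m) → All (0ℤ ≤_) v → 0ℤ ≤ sumℤ v
sumℤ-nonneg []      []       = ℤP.≤-refl
sumℤ-nonneg (b ∷ v) (p ∷ ps) = 0≤i+j p (sumℤ-nonneg v ps)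

sumℤ-nonneg≡0 : ∀ {m} (v : Vec ℤ m) → All (0ℤ ≤_) v → sumℤ v ≡ 0ℤ → All (_≡ 0ℤ) v
sumℤ-nonneg≡0 []      []       _   = []
sumℤ-nonneg≡0 (a ∷ v) (p ∷ ps) sum≡0 =
  a≡0 ∷ sumℤ-nonneg≡0 v ps (trans (sym (ℤP.+-identityˡ _)) (trans (cong (_+ sumℤ v) (sym a≡0)) sum≡0))
  where
  a≡0 : a ≡ 0ℤ
  a≡0 = ℤP.≤-antisym (subst (a ≤_) sum≡0 (subst (_≤ a + sumℤ v) (ℤP.+-identityʳ a)
                       (ℤP.+-monoʳ-≤ a (sumℤ-nonneg v ps)))) p

sumℤ-nonneg≤0 : ∀ {m} (v : Vec ℤ m) → All (0ℤ ≤_) v → sumℤ v ≤ 0ℤ → All (_≤ 0ℤ) v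
sumℤ-nonneg≤0 []      []       _ = []
sumℤ-nonneg≤0 (a ∷ v) (p ∷ ps) s = a≤0 ∷ sumℤ-nonneg≤0 v ps sv≤0
  where
  a≤0 : a ≤ 0ℤ
  a≤0 = ℤP.≤-trans (subst (_≤ a + sumℤ v) (ℤP.+-identityʳ a) (ℤP.+-monoʳ-≤ a (sumℤ-nonneg v ps))) s
  sv≤0 : sumℤ v ≤ 0ℤ
  sv≤0 = ℤP.≤-trans (subst (_≤ a + sumℤ v) (ℤP.+-identityˡ (sumℤ v)) (ℤP.+-monoˡ-≤ (sumℤ v) p)) s

dot-self≡0⇒zeros : ∀ {m} (r : Vec ℤ m) → dot r r ≡ 0ℤ → All (_≡ 0ℤ) r
dot-self≡0⇒zeros r r·r≡0 =
  unsquare r (sumℤ-nonneg≡0 (squares r) (squares-nonneg r) (trans (sym (dot-self≡sum-squares r)) r·r≡0))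
  where
  squares-nonneg : ∀ {m} (r : Vec ℤ m) → All (0ℤ ≤_) (squares r)
  squares-nonneg []      = []
  squares-nonneg (a ∷ r) = 0≤i*i a ∷ squares-nonneg r
  i*i≡0⇒i≡0 : ∀ a → a * a ≡ 0ℤ → a ≡ 0ℤ
  i*i≡0⇒i≡0 a a*a≡0 with ℤP.i*j≡0⇒i≡0∨j≡0 a a*a≡0
  ... | inj₁ a≡0 = a≡0
  ... | inj₂ a≡0 = a≡0
  unsquare : ∀ {m} (r : Vec ℤ m) → All (_≡ 0ℤ) (squares r) → All (_≡ 0ℤ) r
  unsquare []      []       = []
  unsquare (a ∷ r) (q ∷ qs) = i*i≡0⇒i≡0 a q ∷ unsquare r qs

dot-self-0-or-D : ∀ D {m} (z : Vec ℤ m) → All (λ a → a ≡ 0ℤ ⊎ a ≡ D) z → dot z z ≡ D * sumℤ z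
dot-self-0-or-D D []         []               = sym (ℤP.*-zeroʳ D)
dot-self-0-or-D D (.0ℤ ∷ z) (inj₁ refl ∷ ps) =
  trans (ℤP.+-identityˡ _) (trans (dot-self-0-or-D D z ps) (cong (D *_) (sym (ℤP.+-identityˡ _))))
dot-self-0-or-D D (.D ∷ z)  (inj₂ refl ∷ ps) =
  trans (cong (λ t → D * D + t) (dot-self-0-or-D D z ps)) (sym (ℤP.*-distribˡ-+ D D (sumℤ z)))

↭-subst : ∀ {A : Set} {m} {x x′ y y′ : Vec A m} → x ≡ x′ → y ≡ y′ → x ↭ y → x′ ↭ y′
↭-subst refl refl p = p

↭-dot-self : ∀ {m} {x y : Vec ℤ m} → x ↭ y → dot x x ≡ dot y y
↭-dot-self {x = x} {y} p =
  trans (dot-self≡sum-squares x) (trans (sumℤ-resp-↭ (↭-map (λ a → a * a) p)) (sym (dot-self≡sum-squares y)))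

↭-transport : ∀ {m} {x y : Vec ℤ m} → x ↭ y → (g : Vec ℤ m) →
              Σ (Vec ℤ m) λ g′ → (g ↭ g′) × (dot x g ≡ dot y g′) × (∀ c → subv c x g ↭ subv c y g′)
↭-transport {x = x} {y} p g with ↭-zip p g
... | g′ , q = g′ , ↭-subst (zip-proj₂ x g) (zip-proj₂ y g′) (↭-map proj₂ q)
             , trans (dot-zip x g) (trans (sumℤ-resp-↭ (↭-map mul q)) (sym (dot-zip y g′)))
             , λ c → ↭-subst (sym (subv-zip c x g)) (sym (subv-zip c y g′)) (↭-map (subp c) q)
  where
  mul : ℤ × ℤ → ℤ
  mul (a , b) = a * b
  subp : ℤ → ℤ × ℤ → ℤ
  subp c (a , b) = a - c * b
  dot-zip : ∀ {m} (x y : Vec ℤ m) → dot x y ≡ sumℤ (V.map mul (V.zip x y))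
  dot-zip []      []      = refl
  dot-zip (a ∷ x) (b ∷ y) = cong (λ t → a * b + t) (dot-zip x y)
  subv-zip : ∀ c {m} (x y : Vec ℤ m) → subv c x y ≡ V.map (subp c) (V.zip x y)
  subv-zip c []      []      = refl
  subv-zip c (a ∷ x) (b ∷ y) = cong (_ ∷_) (subv-zip c x y)
  zip-proj₂ : ∀ {m} (x y : Vec ℤ m) → V.map proj₂ (V.zip x y) ≡ y
  zip-proj₂ []      []      = refl
  zip-proj₂ (a ∷ x) (b ∷ y) = cong (b ∷_) (zip-proj₂ x y)

-- Unit s r says r = s eᵢ for some i, UnitDiff r says r = ±(eᵢ − eⱼ) with i < j.

data Unit (s : ℤ) : ∀ {m} → Vec ℤ m → Set where
  here  : ∀ {m} {r : Vec ℤ m} → All (_≡ 0ℤ) r → Unit s (s ∷ r)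
  there : ∀ {m} {r : Vec ℤ m} → Unit s r → Unit s (0ℤ ∷ r)

data UnitDiff : ∀ {m} → Vec ℤ m → Set where
  there : ∀ {m} {r : Vec ℤ m} → UnitDiff r → UnitDiff (0ℤ ∷ r)
  plus  : ∀ {m} {r : Vec ℤ m} → Unit (- 1ℤ) r → UnitDiff (1ℤ ∷ r)
  minus : ∀ {m} {r : Vec ℤ m} → Unit 1ℤ r → UnitDiff (- 1ℤ ∷ r)

unit-shape : ∀ s {m} (u : Vec ℤ m) → (s ≡ 1ℤ ⊎ s ≡ - 1ℤ) → sumℤ u ≡ s → dot u u ≡ 1ℤ → Unit s u
unit-shape s []         (inj₁ refl) () _
unit-shape s []         (inj₂ refl) () _
unit-shape s (+ 0 ∷ u) s≡±1 sum≡ dot≡ =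
  there (unit-shape s u s≡±1 (trans (sym (ℤP.+-identityˡ _)) sum≡) (trans (sym (ℤP.+-identityˡ _)) dot≡))
unit-shape s (+ 1 ∷ u) _ sum≡ dot≡ = subst (λ h → Unit s (h ∷ u)) (sym 1≡s) (here zs)
  where
  zs : All (_≡ 0ℤ) u
  zs = dot-self≡0⇒zeros u (+-cancelˡ-≡ 1ℤ _ _ (trans dot≡ (sym (ℤP.+-identityʳ 1ℤ))))
  1≡s : 1ℤ ≡ s
  1≡s = trans (cong (λ t → 1ℤ + t) (sym (sumℤ-zeros u zs))) sum≡
unit-shape s (+ suc (suc a) ∷ u) _ _ dot≡ =
  ⊥-elim (|i|≥2-square-contra (+ suc (suc a)) (dot u u) 1 (s≤s z≤n) dot≡ (dot-self-nonneg u) (inj₁ (+≤+ (s≤s (s≤s z≤n)))))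
unit-shape s (-[1+ 0 ] ∷ u) _ sum≡ dot≡ = subst (λ h → Unit s (h ∷ u)) (sym -1≡s) (here zs)
  where
  zs : All (_≡ 0ℤ) u
  zs = dot-self≡0⇒zeros u (+-cancelˡ-≡ 1ℤ _ _ (trans dot≡ (sym (ℤP.+-identityʳ 1ℤ))))
  -1≡s : -[1+ 0 ] ≡ s
  -1≡s = trans (cong (λ t → -[1+ 0 ] + t) (sym (sumℤ-zeros u zs))) sum≡
unit-shape s (-[1+ suc a ] ∷ u) _ _ dot≡ =
  ⊥-elim (|i|≥2-square-contra -[1+ suc a ] (dot u u) 1 (s≤s z≤n) dot≡ (dot-self-nonneg u) (inj₂ (-≤- (s≤s z≤n))))

unitDiff-shape : ∀ {m} (δ : Vec ℤ m) → sumℤ δ ≡ 0ℤ → dot δ δ ≡ + 2 → UnitDiff δ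
unitDiff-shape []          _ ()
unitDiff-shape (+ 0 ∷ δ)   sum≡ dot≡ =
  there (unitDiff-shape δ (trans (sym (ℤP.+-identityˡ _)) sum≡) (trans (sym (ℤP.+-identityˡ _)) dot≡))
unitDiff-shape (+ 1 ∷ δ)   sum≡ dot≡ =
  plus (unit-shape (- 1ℤ) δ (inj₂ refl) (+-cancelˡ-≡ 1ℤ _ _ sum≡) (+-cancelˡ-≡ 1ℤ _ _ dot≡))
unitDiff-shape (+ suc (suc a) ∷ δ) _ dot≡ =
  ⊥-elim (|i|≥2-square-contra (+ suc (suc a)) (dot δ δ) 2 (s≤s (s≤s z≤n)) dot≡ (dot-self-nonneg δ) (inj₁ (+≤+ (s≤s (s≤s z≤n)))))
unitDiff-shape (-[1+ 0 ] ∷ δ) sum≡ dot≡ =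
  minus (unit-shape 1ℤ δ (inj₁ refl) (+-cancelˡ-≡ (- 1ℤ) _ _ sum≡) (+-cancelˡ-≡ 1ℤ _ _ dot≡))
unitDiff-shape (-[1+ suc a ] ∷ δ) _ dot≡ =
  ⊥-elim (|i|≥2-square-contra -[1+ suc a ] (dot δ δ) 2 (s≤s (s≤s z≤n)) dot≡ (dot-self-nonneg δ) (inj₂ (-≤- (s≤s z≤n))))

-- Reflecting a ∷ x in s ∷ u = s (e₀ − eⱼ) exchanges a and xⱼ.
subv-unit-↭ : ∀ s → s * s ≡ 1ℤ → ∀ {m} (u x : Vec ℤ m) a c → Unit (- s) u → c ≡ a * s + dot x u →
              (a - c * s) ∷ subv c x u ↭ a ∷ x
subv-unit-↭ s s²≡1 (.(- s) ∷ r) (b ∷ x) a c (here zs) c≡ =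
  ↭-subst (cong₂ _∷_ (sym a′≡b) (cong₂ _∷_ (sym b′≡a) (sym (subv-zeroʳ c x r zs)))) refl (swap b a (↭-refl x))
  where
  x·r≡0 : dot x r ≡ 0ℤ
  x·r≡0 = dot-zeroʳ x r zs
  a′≡b : a - c * s ≡ b
  a′≡b = trans (cong (λ t → a - t * s) c≡)
    (trans (solve 4 (λ a s b D → a :- (a :* s :+ (b :* (:- s) :+ D)) :* s := a :+ (b :- a) :* (s :* s) :- D :* s) refl a s b (dot x r))
      (trans (cong₂ (λ t u → a + (b - a) * t - u * s) s²≡1 x·r≡0)
        (solve 3 (λ a b s → a :+ (b :- a) :* con 1ℤ :- con 0ℤ :* s := b) refl a b s)))
  b′≡a : b - c * (- s) ≡ a
  b′≡a = trans (cong (λ t → b - t * (- s)) c≡)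
    (trans (solve 4 (λ a s b D → b :- (a :* s :+ (b :* (:- s) :+ D)) :* (:- s) := b :+ (a :- b) :* (s :* s) :+ D :* s) refl a s b (dot x r))
      (trans (cong₂ (λ t u → b + (a - b) * t + u * s) s²≡1 x·r≡0)
        (solve 3 (λ a b s → b :+ (a :- b) :* con 1ℤ :+ con 0ℤ :* s := a) refl a b s)))
subv-unit-↭ s s²≡1 (.0ℤ ∷ u) (b ∷ x) a c (there p) c≡ =
  ↭-trans (swap _ _ (↭-refl _)) (↭-trans (prep (b - c * 0ℤ) ih)
    (↭-subst (cong (_∷ (a ∷ x)) (sym b′≡b)) refl (swap b a (↭-refl x))))
  where
  ih : (a - c * s) ∷ subv c x u ↭ a ∷ x
  ih = subv-unit-↭ s s²≡1 u x a c p
         (trans c≡ (cong (λ t → a * s + t) (trans (cong (_+ dot x u) (ℤP.*-zeroʳ b)) (ℤP.+-identityˡ _))))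
  b′≡b : b - c * 0ℤ ≡ b
  b′≡b = solve 2 (λ b c → b :- c :* con 0ℤ := b) refl b c

subv-unitDiff-↭ : ∀ {m} (δ x : Vec ℤ m) → UnitDiff δ → ∀ c → c ≡ dot x δ → subv c x δ ↭ x
subv-unitDiff-↭ (.0ℤ ∷ δ) (a ∷ x) (there p) c c≡ =
  ↭-subst (cong (_∷ subv c x δ) (sym (solve 2 (λ a c → a :- c :* con 0ℤ := a) refl a c))) refl
    (prep a (subv-unitDiff-↭ δ x p c (trans c≡ (trans (cong (_+ dot x δ) (ℤP.*-zeroʳ a)) (ℤP.+-identityˡ _)))))
subv-unitDiff-↭ (.1ℤ ∷ δ)     (a ∷ x) (plus p)  c c≡ = subv-unit-↭ 1ℤ refl δ x a c p c≡
subv-unitDiff-↭ (.(- 1ℤ) ∷ δ) (a ∷ x) (minus p) c c≡ = subv-unit-↭ (- 1ℤ) refl δ x a c p c≡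

subv-ABA : ∀ p g₁ g₂ {m} (x a b : Vec ℤ m) → subv g₂ (subv g₁ (subv p x a) b) a ≡ subv g₁ (subv (p + g₂) x a) b
subv-ABA p g₁ g₂ []       []       []       = refl
subv-ABA p g₁ g₂ (x ∷ xs) (a ∷ as) (b ∷ bs) =
  cong₂ _∷_ (solve 6 (λ p g₁ g₂ x a b → x :- p :* a :- g₁ :* b :- g₂ :* a := x :- (p :+ g₂) :* a :- g₁ :* b) refl p g₁ g₂ x a b)
            (subv-ABA p g₁ g₂ xs as bs)

subv-ABABA : ∀ p g₁ g₂ g₃ g₄ {m} (x a b : Vec ℤ m) →
             subv g₄ (subv g₃ (subv g₂ (subv g₁ (subv p x a) b) a) b) a ≡ subv (g₁ + g₃) (subv ((p + g₂) + g₄) x a) b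
subv-ABABA p g₁ g₂ g₃ g₄ []       []       []       = refl
subv-ABABA p g₁ g₂ g₃ g₄ (x ∷ xs) (a ∷ as) (b ∷ bs) =
  cong₂ _∷_ (solve 8 (λ p g₁ g₂ g₃ g₄ x a b → x :- p :* a :- g₁ :* b :- g₂ :* a :- g₃ :* b :- g₄ :* a
                                            := x :- ((p :+ g₂) :+ g₄) :* a :- (g₁ :+ g₃) :* b) refl p g₁ g₂ g₃ g₄ x a b)
            (subv-ABABA p g₁ g₂ g₃ g₄ xs as bs)

subv-difference : ∀ e {m} (x a b : Vec ℤ m) → subv e x (subv 1ℤ a b) ≡ subv (- e) (subv e x a) b
subv-difference e []       []       []       = refl
subv-difference e (x ∷ xs) (a ∷ as) (b ∷ bs) =
  cong₂ _∷_ (solve 4 (λ e x a b → x :- e :* (a :- con 1ℤ :* b) := x :- e :* a :- (:- e) :* b) refl e x a b)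
            (subv-difference e xs as bs)

-- The bilinear form

-- A pair (x , d) stands for x with degree d. On Valid pairs, Σ x = k d, so the term
-- (2 - k)/k² (Σ x)(Σ y) of the form becomes the integer (2 - k) d e.
module Form (k : ℕ) where

  Tagged : ℕ → Set
  Tagged m = Vec ℤ m × ℤ

  vec : ∀ {m} → Tagged m → Vec ℤ m
  vec = proj₁

  tag : ∀ {m} → Tagged m → ℤ
  tag = proj₂

  Valid : ∀ {m} → Tagged m → Set
  Valid (x , d) = sumℤ x ≡ + k * d

  κ : ℤ
  κ = + 2 - + k

  ip : ∀ {m} → Tagged m → Tagged m → ℤ
  ip (x , d) (y , e) = dot x y + κ * (d * e)

  sub : ℤ → ∀ {m} → Tagged m → Tagged m → Tagged m
  sub c (x , d) (g , e) = subv c x g , d - c * e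

  reflect : ∀ {m} → Tagged m → Tagged m → Tagged m
  reflect g u = sub (ip u g) u g

  neg : ∀ {m} → Tagged m → Tagged m
  neg (x , d) = V.map -_ x , - d

  ip-comm : ∀ {m} (u w : Tagged m) → ip u w ≡ ip w u
  ip-comm (x , d) (y , e) = cong₂ _+_ (dot-comm x y) (cong (κ *_) (ℤP.*-comm d e))

  ip-sub : ∀ c {m} (u g w : Tagged m) → ip (sub c u g) w ≡ ip u w - c * ip g w
  ip-sub c (x , d) (g , e) (y , f) =
    trans (cong (λ t → t + κ * ((d - c * e) * f)) (dot-subv c x g y))
      (solve 8 (λ X c G K d e f Y → (X :- c :* G) :+ K :* ((d :- c :* e) :* f)
                                    := (X :+ K :* (d :* f)) :- c :* (G :+ K :* (e :* f)))
             refl (dot x y) c (dot g y) κ d e f (dot x y))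

  ip-reflect : ∀ {m} (g u w : Tagged m) → ip (reflect g u) w ≡ ip u w - ip u g * ip g w
  ip-reflect g u w = ip-sub (ip u g) u g w

  ip-neg : ∀ {m} (u w : Tagged m) → ip (neg u) w ≡ - ip u w
  ip-neg (x , d) (y , e) =
    trans (cong (λ t → t + κ * (- d * e)) (dot-neg x y))
      (solve 4 (λ X K d e → (:- X) :+ K :* ((:- d) :* e) := :- (X :+ K :* (d :* e))) refl (dot x y) κ d e)

  ip-neg-self : ∀ {m} (u : Tagged m) → ip (neg u) (neg u) ≡ ip u u
  ip-neg-self u = trans (ip-neg u (neg u))
    (trans (cong -_ (trans (ip-comm u (neg u)) (ip-neg u u))) (ℤP.neg-involutive _))

  sub-sub : ∀ a b {m} (u g : Tagged m) → sub a (sub b u g) g ≡ sub (b + a) u g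
  sub-sub a b (x , d) (g , e) =
    cong₂ _,_ (subv-subv a b x g) (solve 4 (λ d a b e → d :- b :* e :- a :* e := d :- (b :+ a) :* e) refl d a b e)

  sub-zero : ∀ {m} (u g : Tagged m) → sub 0ℤ u g ≡ u
  sub-zero (x , d) (g , e) = cong₂ _,_ (subv-zeroˡ x g) (solve 2 (λ d e → d :- con 0ℤ :* e := d) refl d e)

  sub-cong : ∀ {a b} → a ≡ b → ∀ {m} (u g : Tagged m) → sub a u g ≡ sub b u g
  sub-cong refl u g = refl

  neg-involutive : ∀ {m} (u : Tagged m) → neg (neg u) ≡ u
  neg-involutive (x , d) = cong₂ _,_ (map-neg-involutive x) (ℤP.neg-involutive d)

  reflect-neg : ∀ {m} (g u : Tagged m) → reflect g (neg u) ≡ neg (reflect g u)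
  reflect-neg g (x , d) =
    trans (cong (λ c → sub c (neg (x , d)) g) (ip-neg (x , d) g))
      (cong₂ _,_ (trans (subv-neg _ x (vec g)) (cong (λ c → V.map -_ (subv c x (vec g))) (ℤP.neg-involutive _)))
                 (solve 3 (λ d c e → :- d :- (:- c) :* e := :- (d :- c :* e)) refl d (ip (x , d) g) (tag g)))

  module _ {m} (g : Tagged m) (g·g≡2 : ip g g ≡ + 2) where

    ip-reflect-self : ∀ u → ip (reflect g u) g ≡ - ip u g
    ip-reflect-self u = trans (ip-reflect g u g)
      (trans (cong (λ t → ip u g - ip u g * t) g·g≡2) (solve 1 (λ c → c :- c :* con (+ 2) := :- c) refl (ip u g)))

    reflect-involutive : ∀ u → reflect g (reflect g u) ≡ u
    reflect-involutive u =
      trans (sub-cong (ip-reflect-self u) (reflect g u) g)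
        (trans (sub-sub _ _ u g) (trans (sub-cong (ℤP.+-inverseʳ (ip u g)) u g) (sub-zero u g)))

    reflect-isometry : ∀ u → ip (reflect g u) (reflect g u) ≡ ip u u
    reflect-isometry u =
      trans (ip-reflect g u (reflect g u))
        (trans (cong₂ (λ s t → s - ip u g * t) (trans (ip-comm u (reflect g u)) (ip-reflect g u u))
                                                (trans (ip-comm g (reflect g u)) (ip-reflect-self u)))
          (trans (cong (λ t → ip u u - ip u g * t - ip u g * - ip u g) (ip-comm g u))
            (solve 2 (λ A c → A :- c :* c :- c :* (:- c) := A) refl (ip u u) (ip u g))))

    reflect-self : reflect g g ≡ neg g
    reflect-self = trans (sub-cong g·g≡2 g g)
      (cong₂ _,_ (subv-self (vec g)) (solve 1 (λ d → d :- con (+ 2) :* d := :- d) refl (tag g)))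

  valid-sub : ∀ c {m} {u g : Tagged m} → Valid u → Valid g → Valid (sub c u g)
  valid-sub c {u = x , d} {g , e} vu vg =
    trans (sumℤ-subv c x g) (trans (cong₂ (λ s t → s - c * t) vu vg)
      (solve 4 (λ K d c e → K :* d :- c :* (K :* e) := K :* (d :- c :* e)) refl (+ k) d c e))

  valid-reflect : ∀ {m} {g u : Tagged m} → Valid g → Valid u → Valid (reflect g u)
  valid-reflect {u = u} vg vu = valid-sub _ {u = u} vu vg

  valid-neg : ∀ {m} {u : Tagged m} → Valid u → Valid (neg u)
  valid-neg {u = x , d} vu =
    trans (sumℤ-neg x) (trans (cong -_ vu) (solve 2 (λ K d → :- (K :* d) := K :* (:- d)) refl (+ k) d))

  sub-ABA : ∀ p g₁ g₂ {m} (v A B : Tagged m) → sub g₂ (sub g₁ (sub p v A) B) A ≡ sub g₁ (sub (p + g₂) v A) B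
  sub-ABA p g₁ g₂ (x , d) (a , e) (b , f) =
    cong₂ _,_ (subv-ABA p g₁ g₂ x a b)
      (solve 6 (λ p g₁ g₂ d e f → d :- p :* e :- g₁ :* f :- g₂ :* e := d :- (p :+ g₂) :* e :- g₁ :* f) refl p g₁ g₂ d e f)

  sub-ABABA : ∀ p g₁ g₂ g₃ g₄ {m} (v A B : Tagged m) →
              sub g₄ (sub g₃ (sub g₂ (sub g₁ (sub p v A) B) A) B) A ≡ sub (g₁ + g₃) (sub ((p + g₂) + g₄) v A) B
  sub-ABABA p g₁ g₂ g₃ g₄ (x , d) (a , e) (b , f) =
    cong₂ _,_ (subv-ABABA p g₁ g₂ g₃ g₄ x a b)
      (solve 8 (λ p g₁ g₂ g₃ g₄ d e f → d :- p :* e :- g₁ :* f :- g₂ :* e :- g₃ :* f :- g₄ :* e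
                                      := d :- ((p :+ g₂) :+ g₄) :* e :- (g₁ :+ g₃) :* f) refl p g₁ g₂ g₃ g₄ d e f)

  sub-difference : ∀ e {m} (u A B : Tagged m) → sub e u (sub 1ℤ A B) ≡ sub (- e) (sub e u A) B
  sub-difference e (x , d) (a , g) (b , h) =
    cong₂ _,_ (subv-difference e x a b)
      (solve 4 (λ e d g h → d :- e :* (g :- con 1ℤ :* h) := d :- e :* g :- (:- e) :* h) refl e d g h)

ones : ℕ → (m : ℕ) → Vec ℤ m
ones zero    m       = V.replicate m 0ℤ
ones (suc j) zero    = []
ones (suc j) (suc m) = 1ℤ ∷ ones j m

betaV≡ones : ∀ j m → betaV j m ≡ ones j m
betaV≡ones zero    zero    = refl
betaV≡ones zero    (suc m) = cong (0ℤ ∷_) (betaV≡ones zero m)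
betaV≡ones (suc j) zero    = refl
betaV≡ones (suc j) (suc m) = cong (1ℤ ∷_) (betaV≡ones j m)

dot-ones : ∀ j {m} (x : Vec ℤ m) → dot x (ones j m) ≡ sumTake j x
dot-ones zero    []      = refl
dot-ones zero    (a ∷ x) = trans (cong₂ _+_ (ℤP.*-zeroʳ a) (dot-ones zero x)) refl
dot-ones (suc j) []      = refl
dot-ones (suc j) (a ∷ x) = cong₂ _+_ (ℤP.*-identityʳ a) (dot-ones j x)

subv-ones : ∀ c j {m} (x : Vec ℤ m) → subv c x (ones j m) ≡ addFirst j (- c) x
subv-ones c zero    []      = refl
subv-ones c zero    (a ∷ x) = cong₂ _∷_ (solve 2 (λ a c → a :- c :* con 0ℤ := a) refl a c) (subv-ones c zero x)
subv-ones c (suc j) []      = refl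
subv-ones c (suc j) (a ∷ x) = cong₂ _∷_ (solve 2 (λ a c → a :- c :* con 1ℤ := a :+ (:- c)) refl a c) (subv-ones c j x)

sumℤ-ones : ∀ j m → j ℕ.≤ m → sumℤ (ones j m) ≡ + j
sumℤ-ones zero    zero    _       = refl
sumℤ-ones zero    (suc m) _       = trans (ℤP.+-identityˡ _) (sumℤ-ones zero m z≤n)
sumℤ-ones (suc j) (suc m) (s≤s j≤m) = cong (λ t → 1ℤ + t) (sumℤ-ones j m j≤m)

IsBit : ℤ → Set
IsBit a = a ≡ 0ℤ ⊎ a ≡ 1ℤ

Binary : ∀ {m} → Vec ℤ m → Set
Binary = All IsBit

bit-bounds : ∀ {a} → IsBit a → (0ℤ ≤ a) × (a ≤ 1ℤ)
bit-bounds (inj₁ refl) = ℤP.≤-refl , +≤+ z≤n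
bit-bounds (inj₂ refl) = +≤+ z≤n , ℤP.≤-refl

ones-binary : ∀ j m → Binary (ones j m)
ones-binary zero    zero    = []
ones-binary zero    (suc m) = inj₁ refl ∷ ones-binary zero m
ones-binary (suc j) zero    = []
ones-binary (suc j) (suc m) = inj₂ refl ∷ ones-binary j m

binary-dot-self : ∀ {m} (x : Vec ℤ m) → Binary x → dot x x ≡ sumℤ x
binary-dot-self []         []             = refl
binary-dot-self (.0ℤ ∷ x) (inj₁ refl ∷ bs) = cong (λ t → 0ℤ + t) (binary-dot-self x bs)
binary-dot-self (.1ℤ ∷ x) (inj₂ refl ∷ bs) = cong (λ t → 1ℤ + t) (binary-dot-self x bs)

-- Σ (xᵢ² − xᵢ) = 0 with non-negative summands.
dot-self≡sum⇒binary : ∀ {m} (x : Vec ℤ m) → dot x x ≡ sumℤ x → Binary x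
dot-self≡sum⇒binary x x·x≡Σx =
  bits x (sumℤ-nonneg≡0 (V.map f x) (f-nonneg x)
           (trans (sumℤ-f x) (trans (cong (_- sumℤ x) x·x≡Σx) (ℤP.+-inverseʳ (sumℤ x)))))
  where
  f : ℤ → ℤ
  f a = a * a - a
  f-nonneg : ∀ {m} (x : Vec ℤ m) → All (0ℤ ≤_) (V.map f x)
  f-nonneg []      = []
  f-nonneg (a ∷ x) = 0≤i*i-i a ∷ f-nonneg x
  sumℤ-f : ∀ {m} (x : Vec ℤ m) → sumℤ (V.map f x) ≡ dot x x - sumℤ x
  sumℤ-f []      = refl
  sumℤ-f (a ∷ x) = trans (cong (λ t → f a + t) (sumℤ-f x))
    (solve 3 (λ a D S → a :* a :- a :+ (D :- S) := a :* a :+ D :- (a :+ S)) refl a (dot x x) (sumℤ x))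
  bit : ∀ a → f a ≡ 0ℤ → IsBit a
  bit a fa≡0 with ℤP.i*j≡0⇒i≡0∨j≡0 a (trans (solve 1 (λ a → a :* (a :- con 1ℤ) := a :* a :- a) refl a) fa≡0)
  ... | inj₁ a≡0   = inj₁ a≡0
  ... | inj₂ a-1≡0 = inj₂ (trans (solve 1 (λ a → a := a :- con 1ℤ :+ con 1ℤ) refl a) (cong (_+ 1ℤ) a-1≡0))
  bits : ∀ {m} (x : Vec ℤ m) → All (_≡ 0ℤ) (V.map f x) → Binary x
  bits []      []       = []
  bits (a ∷ x) (q ∷ qs) = bit a q ∷ bits x qs

binary-dot≤sum : ∀ {m} (a b : Vec ℤ m) → Binary a → Binary b → dot a b ≤ sumℤ a
binary-dot≤sum []      []      []       []       = ℤP.≤-refl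
binary-dot≤sum (x ∷ a) (y ∷ b) (px ∷ pa) (py ∷ pb) = ℤP.+-mono-≤ (bit-product px py) (binary-dot≤sum a b pa pb)
  where
  bit-product : ∀ {x y : ℤ} → IsBit x → IsBit y → x * y ≤ x
  bit-product (inj₁ refl) (inj₁ refl) = ℤP.≤-refl
  bit-product (inj₁ refl) (inj₂ refl) = ℤP.≤-refl
  bit-product (inj₂ refl) (inj₁ refl) = +≤+ z≤n
  bit-product (inj₂ refl) (inj₂ refl) = ℤP.≤-refl

zeros≡replicate : ∀ {m} (z : Vec ℤ m) → All (_≡ 0ℤ) z → z ≡ V.replicate m 0ℤ
zeros≡replicate []      []       = refl
zeros≡replicate (a ∷ z) (p ∷ ps) = cong₂ _∷_ p (zeros≡replicate z ps)

decreasing-binary≡ones : ∀ j {m} (z : Vec ℤ m) → Decreasing z → Binary z → sumℤ z ≡ + j → z ≡ ones j m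
decreasing-binary≡ones zero    []        _         _                _    = refl
decreasing-binary≡ones (suc j) []        _         _                ()
decreasing-binary≡ones zero    (.0ℤ ∷ z) (z≤0 ∷ _) (inj₁ refl ∷ bs) _    =
  cong (0ℤ ∷_) (zeros≡replicate z (nonpositive-bits bs z≤0))
  where
  nonpositive-bits : ∀ {m} {z : Vec ℤ m} → Binary z → All (_≤ 0ℤ) z → All (_≡ 0ℤ) z
  nonpositive-bits []               []        = []
  nonpositive-bits (inj₁ refl ∷ bs) (_ ∷ ps)  = refl ∷ nonpositive-bits bs ps
  nonpositive-bits (inj₂ refl ∷ bs) (+≤+ () ∷ _)
decreasing-binary≡ones (suc j) (.0ℤ ∷ z) (z≤0 ∷ _) (inj₁ refl ∷ bs) sum≡ =
  ⊥-elim (ℤP.<⇒≱ (+<+ (s≤s z≤n)) (subst (_≤ 0ℤ) (trans (sym (ℤP.+-identityˡ _)) sum≡)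
           (sumℤ-nonpos z≤0)))
  where
  sumℤ-nonpos : ∀ {m} {z : Vec ℤ m} → All (_≤ 0ℤ) z → sumℤ z ≤ 0ℤ
  sumℤ-nonpos []       = ℤP.≤-refl
  sumℤ-nonpos (p ∷ ps) = ℤP.+-mono-≤ p (sumℤ-nonpos ps)
decreasing-binary≡ones zero    (.1ℤ ∷ z) _         (inj₂ refl ∷ bs) sum≡ =
  ⊥-elim (ℤP.<⇒≱ (+<+ (s≤s z≤n)) (subst (1ℤ ≤_) sum≡
           (subst (_≤ 1ℤ + sumℤ z) (ℤP.+-identityʳ 1ℤ)
             (ℤP.+-monoʳ-≤ 1ℤ (sumℤ-nonneg z (All.map (λ b → proj₁ (bit-bounds b)) bs))))))
decreasing-binary≡ones (suc j) (.1ℤ ∷ z) (_ ∷ ds) (inj₂ refl ∷ bs) sum≡ =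
  cong (1ℤ ∷_) (decreasing-binary≡ones j z ds bs (+-cancelˡ-≡ 1ℤ _ _ sum≡))

binary-neg-nonpos : ∀ {m} (x : Vec ℤ m) → Binary (V.map -_ x) → All (_≤ 0ℤ) x
binary-neg-nonpos []      []       = []
binary-neg-nonpos (a ∷ x) (b ∷ bs) = nonpos a b ∷ binary-neg-nonpos x bs
  where
  nonpos : ∀ a → IsBit (- a) → a ≤ 0ℤ
  nonpos a (inj₁ -a≡0) = ℤP.≤-reflexive (trans (sym (ℤP.neg-involutive a)) (cong -_ -a≡0))
  nonpos a (inj₂ -a≡1) = subst (_≤ 0ℤ) (trans (cong -_ (sym -a≡1)) (ℤP.neg-involutive a)) -≤+

dot-binary-pair≤ : ∀ D {m} (x a b : Vec ℤ m) → All (λ t → (0ℤ ≤ t) × (t ≤ D)) x → Binary a → Binary b →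
                   dot x a + dot x b ≤ sumℤ x + D * dot a b
dot-binary-pair≤ D [] [] [] [] [] [] =
  ℤP.≤-reflexive (solve 1 (λ D → con 0ℤ :+ con 0ℤ := con 0ℤ :+ D :* con 0ℤ) refl D)
dot-binary-pair≤ D (x ∷ xs) (a ∷ as) (b ∷ bs) ((0≤x , x≤D) ∷ px) (pa ∷ pas) (pb ∷ pbs) =
  ≤-witness _ (solve 8 (λ x a b X Y S E D → (x :+ S) :+ D :* (a :* b :+ E) :- ((x :* a :+ X) :+ (x :* b :+ Y))
                          := (x :+ D :* (a :* b) :- (x :* a :+ x :* b)) :+ (S :+ D :* E :- (X :+ Y)))
                       refl x a b (dot xs as) (dot xs bs) (sumℤ xs) (dot as bs) D)
    (0≤i+j (coordinate pa pb) (ℤP.i≤j⇒0≤j-i (dot-binary-pair≤ D xs as bs px pas pbs)))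
  where
  coordinate : ∀ {a b : ℤ} → IsBit a → IsBit b → 0ℤ ≤ x + D * (a * b) - (x * a + x * b)
  coordinate (inj₁ refl) (inj₁ refl) =
    subst (0ℤ ≤_) (solve 2 (λ x D → x := x :+ D :* (con 0ℤ :* con 0ℤ) :- (x :* con 0ℤ :+ x :* con 0ℤ)) refl x D) 0≤x
  coordinate (inj₁ refl) (inj₂ refl) =
    ℤP.≤-reflexive (solve 2 (λ x D → con 0ℤ := x :+ D :* (con 0ℤ :* con 1ℤ) :- (x :* con 0ℤ :+ x :* con 1ℤ)) refl x D)
  coordinate (inj₂ refl) (inj₁ refl) =
    ℤP.≤-reflexive (solve 2 (λ x D → con 0ℤ := x :+ D :* (con 1ℤ :* con 0ℤ) :- (x :* con 1ℤ :+ x :* con 0ℤ)) refl x D)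
  coordinate (inj₂ refl) (inj₂ refl) =
    subst (0ℤ ≤_) (solve 2 (λ x D → D :- x := x :+ D :* (con 1ℤ :* con 1ℤ) :- (x :* con 1ℤ :+ x :* con 1ℤ)) refl x D)
      (ℤP.i≤j⇒0≤j-i x≤D)

deg-unique : ∀ k {m} (x : Vec ℤ m) d → sumℤ x ≡ + suc k * d → deg (suc k) x ≡ d
deg-unique k x d Σx≡ = ℤP.≤-antisym Q≤d d≤Q
  where
  S = sumℤ x
  K = + suc k
  Q = S /ℕ suc k
  Q≤d : Q ≤ d
  Q≤d = ℤP.*-cancelʳ-≤-pos Q d K (subst (Q * K ≤_) (trans Σx≡ (ℤP.*-comm K d)) (DM.[n/ℕd]*d≤n S (suc k)))
  d≤Q : d ≤ Q
  d≤Q with d ≤? Q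
  ... | yes d≤Q = d≤Q
  ... | no  d≰Q = ⊥-elim (ℤP.<-irrefl refl (ℤP.<-≤-trans (DM.n<s[n/ℕd]*d S (suc k))
          (subst ((1ℤ + Q) * K ≤_) (trans (ℤP.*-comm d K) (sym Σx≡))
            (ℤP.*-monoʳ-≤-nonNeg K (ℤP.i<j⇒suc[i]≤j (ℤP.≰⇒> d≰Q))))))

InZΔ⇒degree : ∀ k {m} (x : Vec ℤ m) → InZΔ k x → Σ ℤ λ d → sumℤ x ≡ + k * d
InZΔ⇒degree k x k∣Σx with Signed.∣ᵤ⇒∣ k∣Σx
... | Signed.divides d Σx≡ = d , trans Σx≡ (ℤP.*-comm d (+ k))


-- Positivity

module _ (k : ℕ) where

  private
    headOnes : ℕ → ℤ
    headOnes zero    = 0ℤ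
    headOnes (suc _) = 1ℤ

    ones-suc : ∀ j m → ones j (suc m) ≡ headOnes j ∷ ones (ℕ.pred j) m
    ones-suc zero    m = refl
    ones-suc (suc j) m = refl

    headOnes+pred : ∀ j → headOnes j + + ℕ.pred j ≡ + j
    headOnes+pred zero    = refl
    headOnes+pred (suc j) = refl

    alphaComb-shift : ∀ m i {l} (cs : Vec ℤ l) → alphaComb (suc m) (suc i) cs ≡ 0ℤ ∷ alphaComb m i cs
    alphaComb-shift m i []       = refl
    alphaComb-shift m i (c ∷ cs) =
      trans (cong (λ t → V.zipWith _+_ (c ·v alphaV (suc m) (suc (suc i))) t) (alphaComb-shift m (suc i) cs))
            (cong (_∷ alphaComb m i (c ∷ cs)) (solve 1 (λ c → c :* con 0ℤ :+ con 0ℤ := con 0ℤ) refl c))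

    tabulate-zeros : ∀ m (f : Fin.Fin m → ℤ) → (∀ i → f i ≡ 0ℤ) → All (_≡ 0ℤ) (V.tabulate f)
    tabulate-zeros zero    f f≡0 = []
    tabulate-zeros (suc m) f f≡0 = f≡0 Fin.zero ∷ tabulate-zeros m (λ i → f (Fin.suc i)) (λ i → f≡0 (Fin.suc i))

    regroup : ∀ {m} (s d c : ℤ) (Z B E A : Vec ℤ m) → All (_≡ 0ℤ) Z →
              V.zipWith _+_ (V.zipWith _+_ (s ·v Z) (d ·v B)) (V.zipWith _+_ (c ·v E) A)
              ≡ V.zipWith _+_ (V.zipWith _+_ (c ·v E) (d ·v B)) A
    regroup s d c []      []      []      []      []          = refl
    regroup s d c (z ∷ Z) (b ∷ B) (e ∷ E) (a ∷ A) (refl ∷ zs) =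
      cong₂ _∷_ (solve 6 (λ s d c b e a → s :* con 0ℤ :+ d :* b :+ (c :* e :+ a) := c :* e :+ d :* b :+ a) refl s d c b e a)
                (regroup s d c Z B E A zs)

    first-coefficient-nonneg : ∀ j (s d y₀ S : ℤ) → 0ℤ ≤ s → y₀ ≤ d → 0ℤ ≤ S → s + d * + j ≡ y₀ + S →
                               0ℤ ≤ s + d * headOnes j - y₀
    first-coefficient-nonneg zero    s d y₀ S _ _ 0≤S eq =
      subst (0ℤ ≤_) (sym (trans (cong (_- y₀) eq) (solve 2 (λ y S → y :+ S :- y := S) refl y₀ S))) 0≤S
    first-coefficient-nonneg (suc j) s d y₀ S 0≤s y₀≤d _ _ =
      ≤-witness _ (solve 3 (λ s d y → s :+ d :* con 1ℤ :- y :- con 0ℤ := s :+ (d :- y)) refl s d y₀) (0≤i+j 0≤s (ℤP.i≤j⇒0≤j-i y₀≤d))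

    -- y = s e₁ + d (e₁ + ⋯ + e_j) + Σ cᵢ αᵢ₊₁, where c₁ = s + d [j > 0] - y₁ and the rest is recursive.
    decompose : ∀ m (y : Vec ℤ (suc m)) (s d : ℤ) (j : ℕ) → 0ℤ ≤ s → 0ℤ ≤ d → All (λ a → (0ℤ ≤ a) × (a ≤ d)) y →
                j ℕ.≤ suc m → s + d * + j ≡ sumℤ y →
                Σ (Vec ℤ m) λ c → All (0ℤ ≤_) c ×
                  (y ≡ V.zipWith _+_ (V.zipWith _+_ (s ·v alphaV (suc m) 0) (d ·v ones j (suc m))) (alphaComb (suc m) 0 c))
    decompose zero (y₀ ∷ []) s d zero _ _ _ _ eq =
      [] , [] , cong (_∷ []) (trans (sym (ℤP.+-identityʳ y₀))
        (trans (sym eq) (solve 2 (λ s d → s :+ d :* con 0ℤ := s :* con 1ℤ :+ d :* con 0ℤ :+ con 0ℤ) refl s d)))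
    decompose zero (y₀ ∷ []) s d (suc zero) _ _ _ _ eq =
      [] , [] , cong (_∷ []) (trans (sym (ℤP.+-identityʳ y₀))
        (trans (sym eq) (solve 2 (λ s d → s :+ d :* con 1ℤ := s :* con 1ℤ :+ d :* con 1ℤ :+ con 0ℤ) refl s d)))
    decompose zero (y₀ ∷ []) s d (suc (suc j)) _ _ _ (s≤s ()) _
    decompose (suc m) (y₀ ∷ ys) s d j 0≤s 0≤d ((_ , y₀≤d) ∷ bounds) j≤ eq =
      c₀ ∷ c′ , 0≤c₀ ∷ 0≤c′ , trans (cong₂ _∷_ head≡ tail≡) (sym regrouped)
      where
      c₀ = s + d * headOnes j - y₀
      0≤c₀ : 0ℤ ≤ c₀
      0≤c₀ = first-coefficient-nonneg j s d y₀ (sumℤ ys) 0≤s y₀≤d (sumℤ-nonneg ys (All.map proj₁ bounds)) eq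
      eq′ : c₀ + d * + ℕ.pred j ≡ sumℤ ys
      eq′ = trans (solve 5 (λ s d a b y₀ → s :+ d :* a :- y₀ :+ d :* b := (s :+ d :* (a :+ b)) :- y₀) refl s d (headOnes j) (+ ℕ.pred j) y₀)
              (trans (cong (λ t → s + d * t - y₀) (headOnes+pred j))
                (trans (cong (_- y₀) eq) (solve 2 (λ y S → y :+ S :- y := S) refl y₀ (sumℤ ys))))
      rest = decompose m ys c₀ d (ℕ.pred j) 0≤c₀ 0≤d bounds (ℕP.pred-mono-≤ j≤) eq′
      c′ : Vec ℤ m
      c′ = proj₁ rest
      0≤c′ : All (0ℤ ≤_) c′
      0≤c′ = proj₁ (proj₂ rest)
      α₀ = alphaV (suc (suc m)) 0
      α₁ = alphaV (suc (suc m)) 1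
      B′ = ones (ℕ.pred j) (suc m)
      A′ = alphaComb (suc m) 0 c′
      regrouped : V.zipWith _+_ (V.zipWith _+_ (s ·v α₀) (d ·v ones j (suc (suc m)))) (alphaComb (suc (suc m)) 0 (c₀ ∷ c′))
                ≡ V.zipWith _+_ (V.zipWith _+_ (s ·v α₀) (d ·v (headOnes j ∷ B′))) (V.zipWith _+_ (c₀ ·v α₁) (0ℤ ∷ A′))
      regrouped = cong₂ (λ b t → V.zipWith _+_ (V.zipWith _+_ (s ·v α₀) (d ·v b)) (V.zipWith _+_ (c₀ ·v α₁) t))
                        (ones-suc j (suc m)) (alphaComb-shift (suc m) 0 c′)
      head≡ : y₀ ≡ s * 1ℤ + d * headOnes j + (c₀ * - 1ℤ + 0ℤ)
      head≡ = solve 4 (λ y₀ s d b → y₀ := s :* con 1ℤ :+ d :* b :+ ((s :+ d :* b :- y₀) :* (:- con 1ℤ) :+ con 0ℤ)) refl y₀ s d (headOnes j)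
      tail≡ : ys ≡ V.zipWith _+_ (V.zipWith _+_ (s ·v V.tail α₀) (d ·v B′)) (V.zipWith _+_ (c₀ ·v V.tail α₁) A′)
      tail≡ = trans (proj₂ (proj₂ rest)) (sym (regroup s d c₀ (V.tail α₀) B′ (V.tail α₁) A′ (tabulate-zeros (suc m) _ (λ _ → refl))))

    zero-·v-⊕ : ∀ {m} (E v : Vec ℤ m) → (0ℤ ·v E) ⊕ v ≡ v
    zero-·v-⊕ []      []      = refl
    zero-·v-⊕ (e ∷ E) (a ∷ v) = cong₂ _∷_ (solve 2 (λ e a → con 0ℤ :* e :+ a := a) refl e a) (zero-·v-⊕ E v)

  bounded⇒positive : ∀ N (x : Vec ℤ N) (d : ℤ) → 0ℤ ≤ d → All (λ a → (0ℤ ≤ a) × (a ≤ d)) x → sumℤ x ≡ + k * d →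
                     k ℕ.≤ N → 1 ℕ.≤ N → IsPositive k N x
  bounded⇒positive (suc m) x d 0≤d bounds Σx≡ k≤N _
    with decompose m x 0ℤ d k ℤP.≤-refl 0≤d bounds k≤N (trans (solve 2 (λ d K → con 0ℤ :+ d :* K := K :* d) refl d (+ k)) (sym Σx≡))
  ... | c , 0≤c , x≡ = d , c , 0≤d , 0≤c ,
    trans x≡ (trans (cong (λ t → t ⊕ alphaComb (suc m) 0 c) (zero-·v-⊕ (alphaV (suc m) 0) (d ·v ones k (suc m))))
                    (cong (λ b → (d ·v b) ⊕ alphaComb (suc m) 0 c) (sym (betaV≡ones k (suc m)))))

-- The root system J_{k,n}

module RootSystem (k n : ℕ) (1≤k : 1 ℕ.≤ k) (k<n : k ℕ.< n) where

  open Form k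

  k≤n : k ℕ.≤ n
  k≤n = ℕP.<⇒≤ k<n

  deg≡ : ∀ {m} (x : Vec ℤ m) d → sumℤ x ≡ + k * d → deg k x ≡ d
  deg≡ x d = subst (λ K → sumℤ x ≡ + K * d → deg K x ≡ d) (ℕP.suc-pred k {{ℕ.>-nonZero 1≤k}})
                   (deg-unique (ℕ.pred k) x d)

  q≡ip : ∀ (x : Vec ℤ n) d → Valid (x , d) → q k x ≡ ip (x , d) (x , d)
  q≡ip x d valid rewrite deg≡ x d valid = cong (_+ κ * (d * d)) (sym (dot-self≡sum-squares x))

  β : Tagged n
  β = ones k n , 1ℤ

  sβ≡reflect : ∀ (x : Vec ℤ n) d → Valid (x , d) → sβ k x ≡ vec (reflect β (x , d))
  sβ≡reflect x d valid rewrite deg≡ x d valid = trans (cong (λ r → addFirst k r x) r≡) (sym (subv-ones _ k x))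
    where
    H = sumTake k x
    T = sumDrop k x
    r≡ : T - + 2 * d ≡ - (dot x (ones k n) + κ * (d * 1ℤ))
    r≡ = begin
      T - + 2 * d                                ≡⟨ solve 4 (λ H T d K → T :- con (+ 2) :* d
                                                     := :- (H :+ (con (+ 2) :- K) :* (d :* con 1ℤ)) :+ ((H :+ T) :- K :* d))
                                                     refl H T d (+ k) ⟩
      - (H + κ * (d * 1ℤ)) + (H + T - + k * d)   ≡⟨ cong (λ t → - (H + κ * (d * 1ℤ)) + (t - + k * d))
                                                      (trans (sym (sumℤ-split k x)) valid) ⟩
      - (H + κ * (d * 1ℤ)) + (+ k * d - + k * d) ≡⟨ cong (λ t → - (H + κ * (d * 1ℤ)) + t) (ℤP.+-inverseʳ (+ k * d)) ⟩
      - (H + κ * (d * 1ℤ)) + 0ℤ                  ≡⟨ ℤP.+-identityʳ _ ⟩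
      - (H + κ * (d * 1ℤ))                       ≡⟨ cong (λ h → - (h + κ * (d * 1ℤ))) (sym (dot-ones k x)) ⟩
      - (dot x (ones k n) + κ * (d * 1ℤ))        ∎
      where open ≡-Reasoning

  valid-dec : ∀ {x : Vec ℤ n} {d} → Valid (x , d) → Valid (dec x , d)
  valid-dec {x} valid = trans (sumℤ-resp-↭ (dec-↭ x)) valid

  -- For d = 1 these are the permutations of β, for d = 0 the vectors eᵢ − eⱼ.
  record Norm₂ (d : ℤ) (u : Tagged n) : Set where
    constructor norm₂
    field
      valid : Valid u
      tag≡  : tag u ≡ d
      norm  : ip u u ≡ + 2

  Deg₁ Deg₀ : Tagged n → Set
  Deg₁ = Norm₂ 1ℤ
  Deg₀ = Norm₂ 0ℤ

  β-deg₁ : Deg₁ β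
  β-deg₁ = norm₂ (trans (sumℤ-ones k n k≤n) (sym (ℤP.*-identityʳ (+ k)))) refl
           (trans (cong (_+ κ * (1ℤ * 1ℤ)) (trans (binary-dot-self (ones k n) (ones-binary k n)) (sumℤ-ones k n k≤n)))
                 (solve 1 (λ K → K :+ (con (+ 2) :- K) :* (con 1ℤ :* con 1ℤ) := con (+ 2)) refl (+ k)))

  β-norm : ip β β ≡ + 2
  β-norm = Norm₂.norm β-deg₁

  deg₁-binary : ∀ {u} → Deg₁ u → Binary (vec u)
  deg₁-binary {x , .1ℤ} (norm₂ valid refl norm) = dot-self≡sum⇒binary x (trans x·x≡k (sym (trans valid (ℤP.*-identityʳ (+ k)))))
    where
    x·x≡k : dot x x ≡ + k
    x·x≡k = trans (solve 2 (λ D K → D := D :+ (con (+ 2) :- K) :* (con 1ℤ :* con 1ℤ) :- con (+ 2) :+ K) refl (dot x x) (+ k))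
              (trans (cong (λ t → t - + 2 + + k) norm) (solve 1 (λ K → con (+ 2) :- con (+ 2) :+ K := K) refl (+ k)))

  deg₁-dec≡ones : ∀ {u} → Deg₁ u → dec (vec u) ≡ ones k n
  deg₁-dec≡ones {x , d} deg₁@(norm₂ valid _ _) =
    decreasing-binary≡ones k (dec x) (dec-decreasing x) (All-resp-↭ (↭-sym (dec-↭ x)) (deg₁-binary deg₁))
      (trans (sumℤ-resp-↭ (dec-↭ x)) (trans valid (trans (cong (+ k *_) (Norm₂.tag≡ deg₁)) (ℤP.*-identityʳ (+ k)))))

  ip-deg₁≤2 : ∀ {A B} → Deg₁ A → Deg₁ B → ip A B ≤ + 2
  ip-deg₁≤2 {a , .1ℤ} {b , .1ℤ} degA@(norm₂ validA refl _) degB@(norm₂ _ refl _) =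
    subst (ip (a , 1ℤ) (b , 1ℤ) ≤_) (solve 1 (λ K → K :+ (con (+ 2) :- K) :* (con 1ℤ :* con 1ℤ) := con (+ 2)) refl (+ k))
      (ℤP.+-monoˡ-≤ (κ * (1ℤ * 1ℤ)) (subst (dot a b ≤_) (trans validA (ℤP.*-identityʳ (+ k)))
        (binary-dot≤sum a b (deg₁-binary degA) (deg₁-binary degB))))

  ip-deg₁≡2⇒≡ : ∀ {A B} → Deg₁ A → Deg₁ B → ip A B ≡ + 2 → A ≡ B
  ip-deg₁≡2⇒≡ {a , .1ℤ} {b , .1ℤ} (norm₂ _ refl normA) (norm₂ _ refl normB) A·B≡2 =
    cong (_, 1ℤ) (subv-1-zeros a b (dot-self≡0⇒zeros (subv 1ℤ a b) δ·δ≡0))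
    where
    A = (a , 1ℤ)
    B = (b , 1ℤ)
    δ = sub 1ℤ A B
    δ·δ≡0 : dot (subv 1ℤ a b) (subv 1ℤ a b) ≡ 0ℤ
    δ·δ≡0 = begin
      dot (vec δ) (vec δ)                              ≡⟨ solve 2 (λ D K → D := D :+ K :* (con 0ℤ :* con 0ℤ)) refl (dot (vec δ) (vec δ)) κ ⟩
      ip δ δ                                           ≡⟨ ip-sub 1ℤ A B δ ⟩
      ip A δ - 1ℤ * ip B δ                             ≡⟨ cong₂ (λ s t → s - 1ℤ * t) (trans (ip-comm A δ) (ip-sub 1ℤ A B A))
                                                                                     (trans (ip-comm B δ) (ip-sub 1ℤ A B B)) ⟩
      ip A A - 1ℤ * ip B A - 1ℤ * (ip A B - 1ℤ * ip B B) ≡⟨ cong₂ (λ s t → s - 1ℤ * t - 1ℤ * (ip A B - 1ℤ * ip B B))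
                                                                  normA (trans (ip-comm B A) A·B≡2) ⟩
      + 2 - 1ℤ * + 2 - 1ℤ * (ip A B - 1ℤ * ip B B)    ≡⟨ cong₂ (λ s t → + 2 - 1ℤ * + 2 - 1ℤ * (s - 1ℤ * t)) A·B≡2 normB ⟩
      0ℤ                                               ∎
      where open ≡-Reasoning
    subv-1-zeros : ∀ {m} (a b : Vec ℤ m) → All (_≡ 0ℤ) (subv 1ℤ a b) → a ≡ b
    subv-1-zeros []      []      []       = refl
    subv-1-zeros (x ∷ a) (y ∷ b) (p ∷ ps) =
      cong₂ _∷_ (trans (solve 2 (λ x y → x := x :- con 1ℤ :* y :+ y) refl x y) (trans (cong (_+ y) p) (ℤP.+-identityˡ y)))
                (subv-1-zeros a b ps)

  -- Here 2 (w, A) lies between -(w·w - Σw) and w·w + Σw, that is between -2 and 2.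
  ip-deg₀-deg₁-bounds : ∀ {w A} → Deg₀ w → Deg₁ A → (- 1ℤ ≤ ip w A) × (ip w A ≤ 1ℤ)
  ip-deg₀-deg₁-bounds {y , .0ℤ} {a , .1ℤ} (norm₂ valid refl norm) degA@(norm₂ _ refl _) = lower , upper
    where
    bits : Binary a
    bits = deg₁-binary degA
    y·y≡2 : dot y y ≡ + 2
    y·y≡2 = trans (solve 2 (λ D K → D := D :+ K :* (con 0ℤ :* con 0ℤ)) refl (dot y y) κ) norm
    Σy≡0 : sumℤ y ≡ 0ℤ
    Σy≡0 = trans valid (ℤP.*-zeroʳ (+ k))
    ip≡dot : ip (y , 0ℤ) (a , 1ℤ) ≡ dot y a
    ip≡dot = solve 2 (λ D K → D :+ K :* (con 0ℤ :* con 1ℤ) := D) refl (dot y a) κ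
    up : ∀ {m} (y a : Vec ℤ m) → Binary a → + 2 * dot y a ≤ dot y y + sumℤ y
    up [] [] [] = ℤP.≤-refl
    up (t ∷ y) (.0ℤ ∷ a) (inj₁ refl ∷ bs) =
      ≤-witness _ (solve 4 (λ t Y S D → t :* t :+ Y :+ (t :+ S) :- con (+ 2) :* (t :* con 0ℤ :+ D)
                               := (t :* t :+ t) :+ (Y :+ S :- con (+ 2) :* D)) refl t (dot y y) (sumℤ y) (dot y a))
        (0≤i+j (0≤i*i+i t) (ℤP.i≤j⇒0≤j-i (up y a bs)))
    up (t ∷ y) (.1ℤ ∷ a) (inj₂ refl ∷ bs) =
      ≤-witness _ (solve 4 (λ t Y S D → t :* t :+ Y :+ (t :+ S) :- con (+ 2) :* (t :* con 1ℤ :+ D)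
                               := (t :* t :- t) :+ (Y :+ S :- con (+ 2) :* D)) refl t (dot y y) (sumℤ y) (dot y a))
        (0≤i+j (0≤i*i-i t) (ℤP.i≤j⇒0≤j-i (up y a bs)))
    down : ∀ {m} (y a : Vec ℤ m) → Binary a → - (+ 2 * dot y a) ≤ dot y y - sumℤ y
    down [] [] [] = ℤP.≤-refl
    down (t ∷ y) (.0ℤ ∷ a) (inj₁ refl ∷ bs) =
      ≤-witness _ (solve 4 (λ t Y S D → t :* t :+ Y :- (t :+ S) :- :- (con (+ 2) :* (t :* con 0ℤ :+ D))
                               := (t :* t :- t) :+ (Y :- S :- :- (con (+ 2) :* D))) refl t (dot y y) (sumℤ y) (dot y a))
        (0≤i+j (0≤i*i-i t) (ℤP.i≤j⇒0≤j-i (down y a bs)))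
    down (t ∷ y) (.1ℤ ∷ a) (inj₂ refl ∷ bs) =
      ≤-witness _ (solve 4 (λ t Y S D → t :* t :+ Y :- (t :+ S) :- :- (con (+ 2) :* (t :* con 1ℤ :+ D))
                               := (t :* t :+ t) :+ (Y :- S :- :- (con (+ 2) :* D))) refl t (dot y y) (sumℤ y) (dot y a))
        (0≤i+j (0≤i*i+i t) (ℤP.i≤j⇒0≤j-i (down y a bs)))
    2ya≤2 : + 2 * dot y a ≤ + 2 * 1ℤ
    2ya≤2 = subst (+ 2 * dot y a ≤_) (cong₂ _+_ y·y≡2 Σy≡0) (up y a bits)
    -2≤2ya : + 2 * (- 1ℤ) ≤ + 2 * dot y a
    -2≤2ya = subst (+ 2 * (- 1ℤ) ≤_) (ℤP.neg-involutive _)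
               (ℤP.neg-mono-≤ (subst (- (+ 2 * dot y a) ≤_) (cong₂ _-_ y·y≡2 Σy≡0) (down y a bits)))
    upper : ip (y , 0ℤ) (a , 1ℤ) ≤ 1ℤ
    upper = subst (_≤ 1ℤ) (sym ip≡dot) (ℤP.*-cancelˡ-≤-pos (dot y a) 1ℤ (+ 2) 2ya≤2)
    lower : - 1ℤ ≤ ip (y , 0ℤ) (a , 1ℤ)
    lower = subst (- 1ℤ ≤_) (sym ip≡dot) (ℤP.*-cancelˡ-≤-pos (- 1ℤ) (dot y a) (+ 2) -2≤2ya)

  tag-reflect-deg₁ : ∀ {u A} → Deg₁ A → tag (reflect A u) ≡ tag u - ip u A
  tag-reflect-deg₁ {u} {A} (norm₂ _ tagA≡1 _) =
    trans (cong (λ s → tag u - ip u A * s) tagA≡1) (cong (λ t → tag u - t) (ℤP.*-identityʳ _))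

  -- Bounded is property (1) and Greedy is property (3), read inductively.

  Bounded : Tagged n → Set
  Bounded u = All (λ a → (0ℤ ≤ a) × (a ≤ tag u)) (vec u)

  greedy : Tagged n → Tagged n
  greedy (x , d) = reflect β (dec x , d)

  data Greedy : Tagged n → Set where
    stop : ∀ {u} → Bounded u → All (_≤ 0ℤ) (vec (greedy u)) → Greedy u
    step : ∀ {u} → Bounded u → Greedy (greedy u) → Greedy u

  Greedy-bounded : ∀ {u} → Greedy u → Bounded u
  Greedy-bounded (stop b _) = b
  Greedy-bounded (step b _) = b

  Candidate : Tagged n → Set
  Candidate u = Valid u × (ip u u ≡ + 2) × Greedy u

  -- The possible results of reflecting a candidate in a permutation of β.
  StepShape : Tagged n → Set
  StepShape u = Candidate u ⊎ Deg₀ u ⊎ Deg₁ (neg u)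

  -- The shape shared by all real roots.
  RootShape : Tagged n → Set
  RootShape u = Candidate u ⊎ Deg₀ u ⊎ Candidate (neg u)

  bounded-tag-nonneg : ∀ {u} → Bounded u → 0ℤ ≤ tag u
  bounded-tag-nonneg bounded with AllP.lookup⁺ bounded (Fin.fromℕ< (ℕP.≤-<-trans (z≤n {k}) k<n))
  ... | 0≤a , a≤d = ℤP.≤-trans 0≤a a≤d

  bounded-reflect-up : ∀ {u A} → Bounded u → Deg₁ A → ip u A ≤ 0ℤ → Bounded (reflect A u)
  bounded-reflect-up {x , d} {a , .1ℤ} bounded degA@(norm₂ _ refl _) p≤0 = entries x a bounded (deg₁-binary degA)
    where
    p = ip (x , d) (a , 1ℤ)
    entries : ∀ {m} (x a : Vec ℤ m) → All (λ t → (0ℤ ≤ t) × (t ≤ d)) x → Binary a →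
         All (λ t → (0ℤ ≤ t) × (t ≤ d - p * 1ℤ)) (subv p x a)
    entries [] [] [] [] = []
    entries (t ∷ x) (.0ℤ ∷ a) ((0≤t , t≤d) ∷ bs) (inj₁ refl ∷ as) =
      ( subst (0ℤ ≤_) (solve 2 (λ t p → t := t :- p :* con 0ℤ) refl t p) 0≤t
      , ≤-witness _ (solve 3 (λ t p d → d :- p :* con 1ℤ :- (t :- p :* con 0ℤ) := (d :- t) :+ (con 0ℤ :- p)) refl t p d)
          (0≤i+j (ℤP.i≤j⇒0≤j-i t≤d) (ℤP.i≤j⇒0≤j-i p≤0))) ∷ entries x a bs as
    entries (t ∷ x) (.1ℤ ∷ a) ((0≤t , t≤d) ∷ bs) (inj₂ refl ∷ as) =
      ( ≤-witness _ (solve 2 (λ t p → t :- p :* con 1ℤ :- con 0ℤ := t :+ (con 0ℤ :- p)) refl t p) (0≤i+j 0≤t (ℤP.i≤j⇒0≤j-i p≤0))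
      , ≤-witness _ (solve 3 (λ t p d → d :- p :* con 1ℤ :- (t :- p :* con 1ℤ) := d :- t) refl t p d) (ℤP.i≤j⇒0≤j-i t≤d)) ∷ entries x a bs as

  -- D (z, β) - (z, z) = D (z₁ + ⋯ + z_k) - Σ zᵢ² ≥ 0, so D (z, β) ≥ 2.
  ip-β-positive : ∀ {z} → Valid z → Decreasing (vec z) → Bounded z → ip z z ≡ + 2 → 1ℤ ≤ tag z → 1ℤ ≤ ip z β
  ip-β-positive {x , D} valid decreasing bounded norm 1≤D = 1≤D*t⇒1≤t (≤-witness _ eq
    (0≤i+j (ℤP.i≤j⇒0≤j-i (sum-squares≤ k D x decreasing bounded 1≤k k≤n valid))
           (subst (λ t → 0ℤ ≤ t - 1ℤ) (sym norm) (+≤+ z≤n))))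
    where
    H = sumTake k x
    S = sumℤ (squares x)
    eq : D * ip (x , D) β - 1ℤ ≡ (D * H - S) + (ip (x , D) (x , D) - 1ℤ)
    eq = begin
      D * (dot x (ones k n) + κ * (D * 1ℤ)) - 1ℤ           ≡⟨ cong (λ h → D * (h + κ * (D * 1ℤ)) - 1ℤ) (dot-ones k x) ⟩
      D * (H + κ * (D * 1ℤ)) - 1ℤ                          ≡⟨ solve 5 (λ D H K S X → D :* (H :+ K :* (D :* con 1ℤ)) :- con 1ℤ
                                                                := (D :* H :- S) :+ (X :+ K :* (D :* D) :- con 1ℤ) :+ (S :- X))
                                                                refl D H κ S (dot x x) ⟩
      (D * H - S) + (ip (x , D) (x , D) - 1ℤ) + (S - dot x x) ≡⟨ cong (λ t → (D * H - S) + (ip (x , D) (x , D) - 1ℤ) + (S - t))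
                                                                  (dot-self≡sum-squares x) ⟩
      (D * H - S) + (ip (x , D) (x , D) - 1ℤ) + (S - S)     ≡⟨ cong (λ t → (D * H - S) + (ip (x , D) (x , D) - 1ℤ) + t)
                                                                  (ℤP.+-inverseʳ S) ⟩
      (D * H - S) + (ip (x , D) (x , D) - 1ℤ) + 0ℤ          ≡⟨ ℤP.+-identityʳ _ ⟩
      (D * H - S) + (ip (x , D) (x , D) - 1ℤ)               ∎
      where open ≡-Reasoning
    1≤D*t⇒1≤t : ∀ {t} → 1ℤ ≤ D * t → 1ℤ ≤ t
    1≤D*t⇒1≤t {t} 1≤Dt with 1ℤ ≤? t
    ... | yes 1≤t = 1≤t
    ... | no  1≰t = ⊥-elim (ℤP.<⇒≱ (+<+ (s≤s z≤n)) (ℤP.≤-trans 1≤Dt (ℤP.≤-trans Dt≤D*0 (ℤP.≤-reflexive (ℤP.*-zeroʳ D)))))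
      where
      Dt≤D*0 : D * t ≤ D * 0ℤ
      Dt≤D*0 = ℤP.*-monoˡ-≤-nonNeg D {{ℤ.nonNegative (ℤP.≤-trans (+≤+ z≤n) 1≤D)}}
                 (ℤP.i<j⇒i≤pred[j] (ℤP.≰⇒> 1≰t))

  ip-dec-β-positive : ∀ {y} → Valid y → Bounded y → ip y y ≡ + 2 → 1ℤ ≤ tag y → 1ℤ ≤ ip (dec (vec y) , tag y) β
  ip-dec-β-positive {x , d} valid bounded norm =
    ip-β-positive {dec x , d} (valid-dec {x} valid) (dec-decreasing x) (All-resp-↭ (↭-sym (dec-↭ x)) bounded)
      (trans (cong (_+ κ * (d * d)) (↭-dot-self (dec-↭ x))) norm)

  greedy-stop⇒tag≡1 : ∀ {u} → Valid u → Bounded u → ip u u ≡ + 2 → All (_≤ 0ℤ) (vec (greedy u)) → tag u ≡ 1ℤ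
  greedy-stop⇒tag≡1 {x , D} valid bounded norm stopped =
    0≤i∧i*i≡1⇒i≡1 D (bounded-tag-nonneg bounded) (ℤP.*-cancelˡ-≡ (+ 2) (D * D) 1ℤ 2D²≡2)
    where
    z = dec x
    bz : All (λ a → (0ℤ ≤ a) × (a ≤ D)) z
    bz = All-resp-↭ (↭-sym (dec-↭ x)) bounded
    Σz≡ : sumℤ z ≡ + k * D
    Σz≡ = valid-dec {x} valid
    bottom≡0 : AllDrop (_≡ 0ℤ) k z
    bottom≡0 = AllDrop-map (λ p → ℤP.≤-antisym (proj₂ p) (proj₁ p)) k z
      (AllDrop-zip k z (All⇒AllDrop k (All.map proj₁ bz))
        (All-addFirst⇒AllDrop k _ z (subst (All (_≤ 0ℤ)) (subv-ones _ k z) stopped)))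
    top≡ : sumTake k z ≡ + k * D
    top≡ = trans (sym (ℤP.+-identityʳ _))
      (trans (cong (λ t → sumTake k z + t) (sym (sumDrop-zeros k z bottom≡0))) (trans (sym (sumℤ-split k z)) Σz≡))
    top≡D : AllTake (_≡ D) k z
    top≡D = sumTake≡⇒AllTake≡ D k z k≤n (All⇒AllTake k (All.map proj₂ bz)) top≡
    x·x≡ : dot x x ≡ D * (+ k * D)
    x·x≡ = trans (sym (↭-dot-self (dec-↭ x)))
      (trans (dot-self-0-or-D D z (AllTake+AllDrop⇒All k z (AllTake-map inj₂ k z top≡D) (AllDrop-map inj₁ k z bottom≡0)))
             (cong (D *_) Σz≡))
    2D²≡2 : + 2 * (D * D) ≡ + 2 * 1ℤ
    2D²≡2 = trans (solve 2 (λ D K → con (+ 2) :* (D :* D) := D :* (K :* D) :+ (con (+ 2) :- K) :* (D :* D)) refl D (+ k))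
                  (trans (cong (_+ κ * (D * D)) (sym x·x≡)) norm)

  negDeg₁-nonpos : ∀ {u} → Deg₁ (neg u) → All (_≤ 0ℤ) (vec u)
  negDeg₁-nonpos {x , _} deg₁ = binary-neg-nonpos x (deg₁-binary deg₁)

  greedy-deg₁ : ∀ {u} → Deg₁ u → greedy u ≡ neg β
  greedy-deg₁ {x , .1ℤ} deg₁@(norm₂ _ refl _) =
    trans (cong (λ z → reflect β (z , 1ℤ)) (deg₁-dec≡ones deg₁)) (reflect-self β β-norm)

  deg₁-candidate : ∀ {u} → Deg₁ u → Candidate u
  deg₁-candidate {x , .1ℤ} deg₁@(norm₂ valid refl norm) =
    valid , norm , stop (All.map bit-bounds (deg₁-binary deg₁))
      (subst (λ w → All (_≤ 0ℤ) (vec w)) (sym (greedy-deg₁ deg₁))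
        (negDeg₁-nonpos {neg β} (subst Deg₁ (sym (neg-involutive β)) β-deg₁)))

  -- reflect β is an involution, so tag y = - (greedy y, β) ≤ 1; then y is a permutation of β.
  greedy-not-deg₀ : ∀ {y} → Valid y → ip y y ≡ + 2 → 1ℤ ≤ tag y → ¬ Deg₀ (greedy y)
  greedy-not-deg₀ {x , D} valid norm 1≤D deg₀@(norm₂ _ tag≡0 _) =
    -1≢0 (trans (sym (cong tag (greedy-deg₁ {x , D} (norm₂ valid (ℤP.≤-antisym D≤1 1≤D) norm)))) tag≡0)
    where
    g = greedy (x , D)
    D≡ : D ≡ 0ℤ - ip g β
    D≡ = trans (sym (cong tag (reflect-involutive β β-norm (dec x , D))))
               (trans (tag-reflect-deg₁ {g} β-deg₁) (cong (_- ip g β) tag≡0))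
    D≤1 : D ≤ 1ℤ
    D≤1 = subst (_≤ 1ℤ) (sym D≡) (subst (_≤ 1ℤ) (sym (ℤP.+-identityˡ _))
            (subst (- ip g β ≤_) (ℤP.neg-involutive 1ℤ) (ℤP.neg-mono-≤ (proj₁ (ip-deg₀-deg₁-bounds {g} deg₀ β-deg₁)))))
    -1≢0 : ¬ (- 1ℤ ≡ 0ℤ)
    -1≢0 ()

  classify : ∀ {u} → Valid u → ip u u ≡ + 2 → tag u ≡ 1ℤ ⊎ tag u ≡ 0ℤ ⊎ tag u ≡ - 1ℤ → StepShape u
  classify valid norm (inj₁ tag≡1)        = inj₁ (deg₁-candidate (norm₂ valid tag≡1 norm))
  classify valid norm (inj₂ (inj₁ tag≡0)) = inj₂ (inj₁ (norm₂ valid tag≡0 norm))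
  classify {u} valid norm (inj₂ (inj₂ tag≡-1)) = inj₂ (inj₂ (norm₂ (valid-neg {u = u} valid) (cong -_ tag≡-1) (trans (ip-neg-self u) norm)))

  candidate-tag-positive : ∀ {u} → Candidate u → 1ℤ ≤ tag u
  candidate-tag-positive {x , d} (_ , norm , greedy-u) with d ℤ.≟ 0ℤ
  ... | no  d≢0 = ℤP.i<j⇒suc[i]≤j (ℤP.≤∧≢⇒< (bounded-tag-nonneg (Greedy-bounded greedy-u)) (λ 0≡d → d≢0 (sym 0≡d)))
  ... | yes refl = ⊥-elim (ℤP.<-irrefl refl (subst (0ℤ <_) 2≡0 (+<+ (s≤s z≤n))))
    where
    x≡0 : All (_≡ 0ℤ) x
    x≡0 = All.map (λ p → ℤP.≤-antisym (proj₂ p) (proj₁ p)) (Greedy-bounded greedy-u)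
    2≡0 : + 2 ≡ 0ℤ
    2≡0 = trans (sym norm) (trans (cong (_+ κ * (0ℤ * 0ℤ)) (dot-zeroʳ x x x≡0))
                                  (solve 1 (λ K → con 0ℤ :+ K :* (con 0ℤ :* con 0ℤ) := con 0ℤ) refl κ))

  infix 4 _≈_

  _≈_ : Tagged n → Tagged n → Set
  u ≈ w = (vec u ↭ vec w) × (tag u ≡ tag w)

  ≈-sym : ∀ {u w} → u ≈ w → w ≈ u
  ≈-sym (p , t) = ↭-sym p , sym t

  ≈-neg : ∀ {u w} → u ≈ w → neg u ≈ neg w
  ≈-neg (p , t) = ↭-map -_ p , cong -_ t

  ≈-valid : ∀ {u w} → u ≈ w → Valid u → Valid w
  ≈-valid {x , d} {y , .d} (p , refl) valid = trans (sym (sumℤ-resp-↭ p)) valid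

  ≈-norm : ∀ {u w} → u ≈ w → ip u u ≡ ip w w
  ≈-norm {x , d} {y , .d} (p , refl) = cong (_+ κ * (d * d)) (↭-dot-self p)

  ≈-Norm₂ : ∀ {d u w} → u ≈ w → Norm₂ d u → Norm₂ d w
  ≈-Norm₂ {u = u} {w} e (norm₂ valid tag≡ norm) =
    norm₂ (≈-valid {u} {w} e valid) (trans (sym (proj₂ e)) tag≡) (trans (sym (≈-norm {u} {w} e)) norm)

  ≈-greedy : ∀ {u w} → u ≈ w → greedy u ≡ greedy w
  ≈-greedy {x , d} {y , .d} (p , refl) = cong (λ z → reflect β (z , d)) (dec-resp-↭ p)

  ≈-Greedy : ∀ {u w} → u ≈ w → Greedy u → Greedy w
  ≈-Greedy {x , d} {y , .d} e@(p , refl) (stop b s) =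
    stop (All-resp-↭ p b) (subst (λ t → All (_≤ 0ℤ) (vec t)) (≈-greedy {x , d} {y , d} e) s)
  ≈-Greedy {x , d} {y , .d} e@(p , refl) (step b g) =
    step (All-resp-↭ p b) (subst Greedy (≈-greedy {x , d} {y , d} e) g)

  ≈-Candidate : ∀ {u w} → u ≈ w → Candidate u → Candidate w
  ≈-Candidate {u} {w} e (valid , norm , g) =
    ≈-valid {u} {w} e valid , trans (sym (≈-norm {u} {w} e)) norm , ≈-Greedy {u} {w} e g

  ≈-StepShape : ∀ {u w} → u ≈ w → StepShape u → StepShape w
  ≈-StepShape {u} {w} e (inj₁ c)        = inj₁ (≈-Candidate {u} {w} e c)
  ≈-StepShape {u} {w} e (inj₂ (inj₁ d)) = inj₂ (inj₁ (≈-Norm₂ {u = u} {w} e d))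
  ≈-StepShape {u} {w} e (inj₂ (inj₂ b)) = inj₂ (inj₂ (≈-Norm₂ {u = neg u} {neg w} (≈-neg {u} {w} e) b))

  ≈-RootShape : ∀ {u w} → u ≈ w → RootShape u → RootShape w
  ≈-RootShape {u} {w} e (inj₁ c)        = inj₁ (≈-Candidate {u} {w} e c)
  ≈-RootShape {u} {w} e (inj₂ (inj₁ d)) = inj₂ (inj₁ (≈-Norm₂ {u = u} {w} e d))
  ≈-RootShape {u} {w} e (inj₂ (inj₂ c)) = inj₂ (inj₂ (≈-Candidate {neg u} {neg w} (≈-neg {u} {w} e) c))

  valid-greedy : ∀ {u} → Valid u → Valid (greedy u)
  valid-greedy {x , d} valid = valid-reflect {g = β} {dec x , d} (Norm₂.valid β-deg₁) (valid-dec {x} valid)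

  norm-greedy : ∀ {u} → ip u u ≡ + 2 → ip (greedy u) (greedy u) ≡ + 2
  norm-greedy {x , d} norm =
    trans (reflect-isometry β β-norm (dec x , d)) (trans (sym (≈-norm {x , d} {dec x , d} (↭-sym (dec-↭ x) , refl))) norm)

  -- Sorting u and reflecting in β is reflecting u in the permutation of β that follows the order of u.
  greedy-as-reflection : ∀ (u : Tagged n) →
    Σ (Tagged n) λ B → Deg₁ B × (greedy u ≈ reflect B u) × (ip u B ≡ ip (dec (vec u) , tag u) β)
  greedy-as-reflection (y , d) with ↭-transport (dec-↭ y) (ones k n)
  ... | b , β↭b , dot≡ , subv↭ = (b , 1ℤ) , deg₁B , greedy≈ , ip≡
    where
    deg₁B : Deg₁ (b , 1ℤ)
    deg₁B = ≈-Norm₂ {u = β} {b , 1ℤ} (β↭b , refl) β-deg₁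
    ip≡ : ip (y , d) (b , 1ℤ) ≡ ip (dec y , d) β
    ip≡ = cong (_+ κ * (d * 1ℤ)) (sym dot≡)
    greedy≈ : greedy (y , d) ≈ reflect (b , 1ℤ) (y , d)
    greedy≈ = subst (λ c → subv (ip (dec y , d) β) (dec y) (ones k n) ↭ subv c y b) (sym ip≡) (subv↭ _)
            , cong (λ c → d - c * 1ℤ) (sym ip≡)

  deg₀-step : ∀ {w A} → Deg₀ w → Deg₁ A → StepShape (reflect A w)
  deg₀-step {w} {A} deg₀@(norm₂ valid tag≡0 norm) degA@(norm₂ validA tagA≡1 normA) =
    classify {reflect A w} (valid-reflect {g = A} {w} validA valid) (trans (reflect-isometry A normA w) norm)
      (between-±1 (tag (reflect A w)) (subst (- 1ℤ ≤_) (sym tag≡) (ℤP.neg-mono-≤ (proj₂ bounds)))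
        (subst (_≤ 1ℤ) (sym tag≡) (subst (- c ≤_) (ℤP.neg-involutive 1ℤ) (ℤP.neg-mono-≤ (proj₁ bounds)))))
    where
    c = ip w A
    bounds : (- 1ℤ ≤ c) × (c ≤ 1ℤ)
    bounds = ip-deg₀-deg₁-bounds {w} {A} deg₀ degA
    tag≡ : tag (reflect A w) ≡ - c
    tag≡ = trans (cong₂ (λ s t → s - c * t) tag≡0 tagA≡1) (solve 1 (λ c → con 0ℤ :- c :* con 1ℤ := :- c) refl c)

  negDeg₁-step : ∀ {w X} → Deg₁ (neg w) → Deg₁ X → ip w X ≤ 0ℤ → StepShape (reflect X w)
  negDeg₁-step {w} {X} neg-deg₁@(norm₂ valid tag≡ norm) degX@(norm₂ validX tagX≡1 normX) ip≤0 =
    classify {reflect X w} (valid-reflect {g = X} {w} validX (subst Valid (neg-involutive w) (valid-neg {u = neg w} valid)))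
      (trans (reflect-isometry X normX w) (trans (sym (ip-neg-self w)) norm))
      (between-±1 (tag (reflect X w)) (subst (- 1ℤ ≤_) (sym tag≡e-1) (ℤP.+-monoˡ-≤ (- 1ℤ) 0≤e))
                                      (subst (_≤ 1ℤ) (sym tag≡e-1) (ℤP.+-monoˡ-≤ (- 1ℤ) e≤2)))
    where
    e = ip (neg w) X
    ip≡-e : ip w X ≡ - e
    ip≡-e = trans (sym (ℤP.neg-involutive _)) (cong -_ (sym (ip-neg w X)))
    e≤2 : e ≤ + 2
    e≤2 = ip-deg₁≤2 neg-deg₁ degX
    0≤e : 0ℤ ≤ e
    0≤e = subst (0ℤ ≤_) (ℤP.neg-involutive e) (ℤP.neg-mono-≤ (subst (_≤ 0ℤ) ip≡-e ip≤0))
    tagw≡-1 : tag w ≡ - 1ℤ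
    tagw≡-1 = trans (sym (ℤP.neg-involutive (tag w))) (cong -_ tag≡)
    tag≡e-1 : tag (reflect X w) ≡ e - 1ℤ
    tag≡e-1 = trans (cong₂ (λ s t → s - ip w X * t) tagw≡-1 tagX≡1)
      (trans (cong (λ t → - 1ℤ - t * 1ℤ) ip≡-e) (solve 1 (λ e → :- con 1ℤ :- (:- e) :* con 1ℤ := e :- con 1ℤ) refl e))

  -- Reflecting candidates in permutations of β

  _≟ᵗ_ : DecidableEquality (Tagged n)
  _≟ᵗ_ = ×-≡-dec (VecP.≡-dec ℤ._≟_) ℤ._≟_

  ReflectionClosed : ℕ → Set
  ReflectionClosed N = ∀ {x A} → Candidate x → Deg₁ A → x ≢ A → tag x ≤ + N → tag (reflect A x) ≤ + N →
                       Candidate (reflect A x) ⊎ Deg₀ (reflect A x)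

  reflect-candidate : ∀ {N} → ReflectionClosed N → ∀ {u X} → Candidate u → Deg₁ X →
                      tag u ≤ + N → tag (reflect X u) ≤ + N → StepShape (reflect X u)
  reflect-candidate closed {u} {X} cand degX t₁ t₂ with u ≟ᵗ X
  ... | yes refl = inj₂ (inj₂ (subst Deg₁ (sym (trans (cong neg (reflect-self X (Norm₂.norm degX))) (neg-involutive X))) degX))
  ... | no u≢X with closed cand degX u≢X t₁ t₂
  ...   | inj₁ c = inj₁ c
  ...   | inj₂ d = inj₂ (inj₁ d)

  reflect-stepShape : ∀ {N} → ReflectionClosed N → ∀ {u X} → StepShape u → Deg₁ X →
                      tag u ≤ + N → tag (reflect X u) ≤ + N → (Deg₁ (neg u) → ip u X ≤ 0ℤ) → StepShape (reflect X u)
  reflect-stepShape closed         (inj₁ c)        degX t₁ t₂ _ = reflect-candidate closed c degX t₁ t₂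
  reflect-stepShape closed {u} {X} (inj₂ (inj₁ d)) degX _  _  _ = deg₀-step {u} {X} d degX
  reflect-stepShape closed {u} {X} (inj₂ (inj₂ b)) degX _  _  h = negDeg₁-step {u} {X} b degX (h b)

  -- Coordinatewise, (v, A) + (v, B) ≤ D ((A, B) + 2), so (A, B) ≤ -2 contradicts (v, A), (v, B) ≥ 1.
  ip-deg₁-pair-bound : ∀ {v A B} → Valid v → Bounded v → Deg₁ A → Deg₁ B → ip A B ≤ - + 2 →
                       1ℤ ≤ ip v A → 1ℤ ≤ ip v B → ⊥
  ip-deg₁-pair-bound {x , D} {a , .1ℤ} {b , .1ℤ} valid bounded degA@(norm₂ _ refl _) degB@(norm₂ _ refl _) c≤-2 1≤p 1≤q =
    ℤP.<⇒≱ (+<+ (s≤s z≤n)) (ℤP.≤-trans (ℤP.+-mono-≤ 1≤p 1≤q) (ℤP.≤-trans p+q≤ D*[c+2]≤0))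
    where
    c : ℤ
    c = ip (a , 1ℤ) (b , 1ℤ)
    p : ℤ
    p = ip (x , D) (a , 1ℤ)
    q′ : ℤ
    q′ = ip (x , D) (b , 1ℤ)
    p+q≤ : p + q′ ≤ D * (c + + 2)
    p+q≤ = ≤-witness _
      (trans (solve 6 (λ D K S xa xb ab → D :* ((ab :+ (con (+ 2) :- K) :* (con 1ℤ :* con 1ℤ)) :+ con (+ 2))
                                           :- ((xa :+ (con (+ 2) :- K) :* (D :* con 1ℤ)) :+ (xb :+ (con (+ 2) :- K) :* (D :* con 1ℤ)))
                                        := (S :+ D :* ab :- (xa :+ xb)) :+ (K :* D :- S))
                      refl D (+ k) (sumℤ x) (dot x a) (dot x b) (dot a b))
        (trans (cong (λ t → (sumℤ x + D * dot a b - (dot x a + dot x b)) + (+ k * D - t)) valid)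
          (trans (cong (λ t → (sumℤ x + D * dot a b - (dot x a + dot x b)) + t) (ℤP.+-inverseʳ (+ k * D))) (ℤP.+-identityʳ _))))
      (ℤP.i≤j⇒0≤j-i (dot-binary-pair≤ D x a b bounded (deg₁-binary degA) (deg₁-binary degB)))
    D*[c+2]≤0 : D * (c + + 2) ≤ 0ℤ
    D*[c+2]≤0 = ≤-witness _ (solve 2 (λ D c → con 0ℤ :- D :* (c :+ con (+ 2)) := D :* (:- (c :+ con (+ 2)))) refl D c)
      (0≤i*j (bounded-tag-nonneg {x , D} bounded) (ℤP.neg-mono-≤ (ℤP.+-monoˡ-≤ (+ 2) c≤-2)))

  -- s_B v is s_A v followed by a word in s_A, s_B (or, when (A, B) = 1, in s_A and the
  -- transposition s_{A-B}) whose partial products all have degree below that of v.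
  module TwoReflections {N : ℕ} (closed : ReflectionClosed N) {v A B : Tagged n}
    (valid : Valid v) (bounded : Bounded v) (norm : ip v v ≡ + 2) (tag≤ : tag v ≤ + suc N)
    (degA : Deg₁ A) (degB : Deg₁ B) (1≤p : 1ℤ ≤ ip v A) (1≤q : 1ℤ ≤ ip v B) (candA : Candidate (reflect A v)) where

    D : ℤ
    D = tag v
    p : ℤ
    p = ip v A
    q′ : ℤ
    q′ = ip v B
    c : ℤ
    c = ip A B
    sAv : Tagged n
    sAv = reflect A v
    normA : ip A A ≡ + 2
    normA = Norm₂.norm degA
    normB : ip B B ≡ + 2
    normB = Norm₂.norm degB

    tag-bound : ∀ t (s : ℤ) → 1ℤ ≤ s → t ≡ D - s → t ≤ + N
    tag-bound t s 1≤s t≡ = subst (_≤ + N) (sym t≡)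
      (≤-witness _ (solve 3 (λ N D s → N :- (D :- s) := ((con 1ℤ :+ N) :- D) :+ (s :- con 1ℤ)) refl (+ N) D s)
        (0≤i+j (ℤP.i≤j⇒0≤j-i tag≤) (ℤP.i≤j⇒0≤j-i 1≤s)))

    ip-BA : ip B A ≡ c
    ip-BA = ip-comm B A

    ip-sAv-A : ip sAv A ≡ - p
    ip-sAv-A = ip-reflect-self A normA v

    ip-sAv-B : ip sAv B ≡ q′ - p * c
    ip-sAv-B = ip-reflect A v B

    tag-sAv : tag sAv ≡ D - p
    tag-sAv = tag-reflect-deg₁ {v} degA

    tag-sBv : tag (reflect B v) ≡ D - q′
    tag-sBv = tag-reflect-deg₁ {v} degB

    tag-sAv≤ : tag sAv ≤ + N
    tag-sAv≤ = tag-bound (tag sAv) p 1≤p tag-sAv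

    tag-sBv≤ : tag (reflect B v) ≤ + N
    tag-sBv≤ = tag-bound (tag (reflect B v)) q′ 1≤q tag-sBv

    -x≤0 : ∀ {x} → 1ℤ ≤ x → - x ≤ 0ℤ
    -x≤0 1≤x = ℤP.neg-mono-≤ (ℤP.≤-trans (+≤+ z≤n) 1≤x)

    case2 : c ≡ + 2 → StepShape (reflect B v)
    case2 c≡2 = subst (λ X → StepShape (reflect X v)) (ip-deg₁≡2⇒≡ degA degB c≡2) (inj₁ candA)

    module Case1 (c≡1 : c ≡ 1ℤ) where
      δ : Tagged n
      δ = sub 1ℤ A B
      tagδ : tag δ ≡ 0ℤ
      tagδ = cong₂ (λ s t → s - 1ℤ * t) (Norm₂.tag≡ degA) (Norm₂.tag≡ degB)
      normδ : ip δ δ ≡ + 2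
      normδ = begin
        ip δ δ                                        ≡⟨ ip-sub 1ℤ A B δ ⟩
        ip A δ - 1ℤ * ip B δ                          ≡⟨ cong₂ (λ s t → s - 1ℤ * t) (trans (ip-comm A δ) (ip-sub 1ℤ A B A))
                                                                                 (trans (ip-comm B δ) (ip-sub 1ℤ A B B)) ⟩
        (ip A A - 1ℤ * ip B A) - 1ℤ * (c - 1ℤ * ip B B) ≡⟨ cong₂ (λ s t → (s - 1ℤ * t) - 1ℤ * (c - 1ℤ * ip B B)) normA (trans ip-BA c≡1) ⟩
        (+ 2 - 1ℤ * 1ℤ) - 1ℤ * (c - 1ℤ * ip B B)      ≡⟨ cong₂ (λ s t → (+ 2 - 1ℤ * 1ℤ) - 1ℤ * (s - 1ℤ * t)) c≡1 normB ⟩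
        + 2                                           ∎
        where open ≡-Reasoning
      Σδ≡0 : sumℤ (vec δ) ≡ 0ℤ
      Σδ≡0 = trans (valid-sub 1ℤ {u = A} {B} (Norm₂.valid degA) (Norm₂.valid degB))
                   (trans (cong (+ k *_) tagδ) (ℤP.*-zeroʳ (+ k)))
      δ·δ≡2 : dot (vec δ) (vec δ) ≡ + 2
      δ·δ≡2 = trans (solve 2 (λ X K → X := X :+ K :* (con 0ℤ :* con 0ℤ)) refl (dot (vec δ) (vec δ)) κ)
                    (trans (cong (λ t → dot (vec δ) (vec δ) + κ * (t * t)) (sym tagδ)) normδ)
      e : ℤ
      e = ip sAv δ
      e≡dot : e ≡ dot (vec sAv) (vec δ)
      e≡dot = trans (cong (λ t → dot (vec sAv) (vec δ) + κ * (tag sAv * t)) tagδ)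
                    (solve 3 (λ X K t → X :+ K :* (t :* con 0ℤ) := X) refl (dot (vec sAv) (vec δ)) κ (tag sAv))
      τ : Tagged n
      τ = reflect δ sAv
      τ≈ : τ ≈ sAv
      τ≈ = subv-unitDiff-↭ (vec δ) (vec sAv) (unitDiff-shape (vec δ) Σδ≡0 δ·δ≡2) e e≡dot
         , trans (cong (λ t → tag sAv - e * t) tagδ) (solve 2 (λ d e → d :- e :* con 0ℤ := d) refl (tag sAv) e)
      e≡-q : e ≡ - q′
      e≡-q = trans (ip-comm sAv δ) (trans (ip-sub 1ℤ A B sAv)
        (trans (cong₂ (λ s t → s - 1ℤ * t) (trans (ip-comm A sAv) ip-sAv-A) (trans (ip-comm B sAv) ip-sAv-B))
          (trans (cong (λ t → - p - 1ℤ * (q′ - p * t)) c≡1)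
            (solve 2 (λ p q → :- p :- con 1ℤ :* (q :- p :* con 1ℤ) := :- q) refl p q′))))
      ip-δA : ip δ A ≡ 1ℤ
      ip-δA = trans (ip-sub 1ℤ A B A) (cong₂ (λ s t → s - 1ℤ * t) normA (trans ip-BA c≡1))
      f : ℤ
      f = ip τ A
      f≡ : f ≡ q′ - p
      f≡ = trans (ip-reflect δ sAv A) (trans (cong₂ (λ s t → s - e * t) ip-sAv-A ip-δA)
             (trans (cong (λ t → - p - t * 1ℤ) e≡-q) (solve 2 (λ p q → :- p :- (:- q) :* con 1ℤ := q :- p) refl p q′)))
      sAτ≡sBv : reflect A τ ≡ reflect B v
      sAτ≡sBv = begin
        sub f (sub e sAv δ) A                        ≡⟨ cong (λ t → sub f t A) (trans (sub-difference e sAv A B)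
                                                          (cong (λ t → sub (- e) t B) (sub-sub e p v A))) ⟩
        sub f (sub (- e) (sub (p + e) v A) B) A       ≡⟨ sub-ABA (p + e) (- e) f v A B ⟩
        sub (- e) (sub ((p + e) + f) v A) B           ≡⟨ cong₂ (λ s t → sub s (sub t v A) B)
                                                          (trans (cong -_ e≡-q) (ℤP.neg-involutive q′))
                                                          (trans (cong₂ (λ s t → (p + s) + t) e≡-q f≡)
                                                                 (solve 2 (λ p q → (p :+ :- q) :+ (q :- p) := con 0ℤ) refl p q′)) ⟩
        sub q′ (sub 0ℤ v A) B                         ≡⟨ cong (λ t → sub q′ t B) (sub-zero v A) ⟩
        reflect B v                                   ∎
        where open ≡-Reasoning
      result : StepShape (reflect B v)
      result = subst StepShape sAτ≡sBv
        (reflect-candidate closed {τ} {A} (≈-Candidate {sAv} {τ} (≈-sym {τ} {sAv} τ≈) candA) degA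
          (subst (_≤ + N) (sym (proj₂ τ≈)) tag-sAv≤) (subst (λ t → tag t ≤ + N) (sym sAτ≡sBv) tag-sBv≤))

    module Case0 (c≡0 : c ≡ 0ℤ) where
      g₁ : ℤ
      g₁ = ip sAv B
      g₁≡ : g₁ ≡ q′
      g₁≡ = trans ip-sAv-B (trans (cong (λ t → q′ - p * t) c≡0) (solve 2 (λ p q → q :- p :* con 0ℤ := q) refl p q′))
      w₁ : Tagged n
      w₁ = reflect B sAv
      tag-w₁ : tag w₁ ≡ D - (p + q′)
      tag-w₁ = trans (tag-reflect-deg₁ {sAv} degB)
        (trans (cong₂ _-_ tag-sAv g₁≡) (solve 3 (λ D p q → D :- p :- q := D :- (p :+ q)) refl D p q′))
      g₂ : ℤ
      g₂ = ip w₁ A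
      g₂≡ : g₂ ≡ - p
      g₂≡ = trans (ip-reflect B sAv A) (trans (cong₂ (λ s t → s - g₁ * t) ip-sAv-A (trans ip-BA c≡0))
              (solve 2 (λ p g → :- p :- g :* con 0ℤ := :- p) refl p g₁))
      sAw₁≡sBv : reflect A w₁ ≡ reflect B v
      sAw₁≡sBv = trans (sub-ABA p g₁ g₂ v A B)
        (trans (cong₂ (λ s t → sub s (sub t v A) B) g₁≡ (trans (cong (λ t → p + t) g₂≡) (ℤP.+-inverseʳ p)))
               (cong (λ t → sub q′ t B) (sub-zero v A)))
      result : StepShape (reflect B v)
      result = subst StepShape sAw₁≡sBv
        (reflect-stepShape closed {w₁} {A}
          (reflect-candidate closed {sAv} {B} candA degB tag-sAv≤ (tag-bound (tag w₁) (p + q′) (1≤i+j 1≤p 1≤q) tag-w₁))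
          degA (tag-bound (tag w₁) (p + q′) (1≤i+j 1≤p 1≤q) tag-w₁) (subst (λ t → tag t ≤ + N) (sym sAw₁≡sBv) tag-sBv≤)
          (λ _ → subst (_≤ 0ℤ) (sym g₂≡) (-x≤0 1≤p)))

    module Case-1 (c≡-1 : c ≡ - 1ℤ) where
      g₁ : ℤ
      g₁ = ip sAv B
      g₁≡ : g₁ ≡ q′ + p
      g₁≡ = trans ip-sAv-B (trans (cong (λ t → q′ - p * t) c≡-1) (solve 2 (λ p q → q :- p :* (:- con 1ℤ) := q :+ p) refl p q′))
      w₁ : Tagged n
      w₁ = reflect B sAv
      tag-w₁ : tag w₁ ≡ D - ((p + p) + q′)
      tag-w₁ = trans (tag-reflect-deg₁ {sAv} degB)
        (trans (cong₂ _-_ tag-sAv g₁≡) (solve 3 (λ D p q → D :- p :- (q :+ p) := D :- ((p :+ p) :+ q)) refl D p q′))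
      tag-w₁≤ : tag w₁ ≤ + N
      tag-w₁≤ = tag-bound (tag w₁) ((p + p) + q′) (1≤i+j (1≤i+j 1≤p 1≤p) 1≤q) tag-w₁
      g₂ : ℤ
      g₂ = ip w₁ A
      g₂≡ : g₂ ≡ q′
      g₂≡ = trans (ip-reflect B sAv A) (trans (cong₂ (λ s t → s - g₁ * t) ip-sAv-A (trans ip-BA c≡-1))
              (trans (cong (λ t → - p - t * (- 1ℤ)) g₁≡) (solve 2 (λ p q → :- p :- (q :+ p) :* (:- con 1ℤ) := q) refl p q′)))
      w₂ : Tagged n
      w₂ = reflect A w₁
      tag-w₂ : tag w₂ ≡ D - ((p + p) + (q′ + q′))
      tag-w₂ = trans (tag-reflect-deg₁ {w₁} degA)
        (trans (cong₂ _-_ tag-w₁ g₂≡) (solve 3 (λ D p q → D :- ((p :+ p) :+ q) :- q := D :- ((p :+ p) :+ (q :+ q))) refl D p q′))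
      tag-w₂≤ : tag w₂ ≤ + N
      tag-w₂≤ = tag-bound (tag w₂) ((p + p) + (q′ + q′)) (1≤i+j (1≤i+j 1≤p 1≤p) (1≤i+j 1≤q 1≤q)) tag-w₂
      ip-w₁-B : ip w₁ B ≡ - (q′ + p)
      ip-w₁-B = trans (ip-reflect-self B normB sAv) (cong -_ g₁≡)
      g₃ : ℤ
      g₃ = ip w₂ B
      g₃≡ : g₃ ≡ - p
      g₃≡ = trans (ip-reflect A w₁ B) (trans (cong₂ (λ s t → s - g₂ * t) ip-w₁-B c≡-1)
              (trans (cong (λ t → - (q′ + p) - t * (- 1ℤ)) g₂≡) (solve 2 (λ p q → :- (q :+ p) :- q :* (:- con 1ℤ) := :- p) refl p q′)))
      w₃ : Tagged n
      w₃ = reflect B w₂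
      tag-w₃ : tag w₃ ≡ D - (p + (q′ + q′))
      tag-w₃ = trans (tag-reflect-deg₁ {w₂} degB)
        (trans (cong₂ _-_ tag-w₂ g₃≡) (solve 3 (λ D p q → D :- ((p :+ p) :+ (q :+ q)) :- (:- p) := D :- (p :+ (q :+ q))) refl D p q′))
      tag-w₃≤ : tag w₃ ≤ + N
      tag-w₃≤ = tag-bound (tag w₃) (p + (q′ + q′)) (1≤i+j 1≤p (1≤i+j 1≤q 1≤q)) tag-w₃
      ip-w₂-A : ip w₂ A ≡ - q′
      ip-w₂-A = trans (ip-reflect-self A normA w₁) (cong -_ g₂≡)
      g₄ : ℤ
      g₄ = ip w₃ A
      g₄≡ : g₄ ≡ - (q′ + p)
      g₄≡ = trans (ip-reflect B w₂ A) (trans (cong₂ (λ s t → s - g₃ * t) ip-w₂-A (trans ip-BA c≡-1))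
              (trans (cong (λ t → - q′ - t * (- 1ℤ)) g₃≡) (solve 2 (λ p q → :- q :- (:- p) :* (:- con 1ℤ) := :- (q :+ p)) refl p q′)))
      sAw₃≡sBv : reflect A w₃ ≡ reflect B v
      sAw₃≡sBv = trans (sub-ABABA p g₁ g₂ g₃ g₄ v A B)
        (trans (cong₂ (λ s t → sub s (sub t v A) B)
                 (trans (cong₂ _+_ g₁≡ g₃≡) (solve 2 (λ p q → (q :+ p) :+ (:- p) := q) refl p q′))
                 (trans (cong₂ (λ s t → (p + s) + t) g₂≡ g₄≡) (solve 2 (λ p q → (p :+ q) :+ (:- (q :+ p)) := con 0ℤ) refl p q′)))
          (cong (λ t → sub q′ t B) (sub-zero v A)))
      shape-w₂ : Candidate w₁ ⊎ Deg₀ w₁ → StepShape w₂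
      shape-w₂ (inj₁ cand) = reflect-candidate closed {w₁} {A} cand degA tag-w₁≤ tag-w₂≤
      shape-w₂ (inj₂ deg₀) = deg₀-step {w₁} {A} deg₀ degA
      sAv≢B⇒result : sAv ≢ B → StepShape (reflect B v)
      sAv≢B⇒result sAv≢B = subst StepShape sAw₃≡sBv
        (reflect-stepShape closed {w₃} {A}
          (reflect-stepShape closed {w₂} {B} (shape-w₂ (closed {sAv} {B} candA degB sAv≢B tag-sAv≤ tag-w₁≤))
            degB tag-w₂≤ tag-w₃≤ (λ _ → subst (_≤ 0ℤ) (sym g₃≡) (-x≤0 1≤p)))
          degA tag-w₃≤ (subst (λ t → tag t ≤ + N) (sym sAw₃≡sBv) tag-sBv≤)
          (λ _ → subst (_≤ 0ℤ) (sym g₄≡) (-x≤0 (1≤i+j 1≤q 1≤p))))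
      -- If s_A v = B then p = 1 and q′ = 1, and s_B v has degree 1.
      sAv≡B⇒result : sAv ≡ B → StepShape (reflect B v)
      sAv≡B⇒result sAv≡B = classify {reflect B v} (valid-reflect {g = B} {v} (Norm₂.valid degB) valid)
                                                  (trans (reflect-isometry B normB v) norm) (inj₁ tag≡1)
        where
        q+p≡2 : q′ + p ≡ + 2
        q+p≡2 = trans (sym g₁≡) (trans (cong (λ t → ip t B) sAv≡B) normB)
        D≡1+p : D ≡ 1ℤ + p
        D≡1+p = trans (cong tag (sym (reflect-involutive A normA v)))
          (trans (tag-reflect-deg₁ {sAv} degA)
            (trans (cong₂ _-_ (trans (cong tag sAv≡B) (Norm₂.tag≡ degB)) ip-sAv-A) (solve 1 (λ p → con 1ℤ :- (:- p) := con 1ℤ :+ p) refl p)))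
        p≤1 : p ≤ 1ℤ
        p≤1 = ≤-witness _
          (trans (solve 2 (λ p q → con 1ℤ :- p := (q :- con 1ℤ) :+ (con (+ 2) :- (q :+ p))) refl p q′)
            (trans (cong (λ t → (q′ - 1ℤ) + (+ 2 - t)) q+p≡2)
              (trans (cong (λ t → (q′ - 1ℤ) + t) (ℤP.+-inverseʳ (+ 2))) (ℤP.+-identityʳ _))))
          (ℤP.i≤j⇒0≤j-i 1≤q)
        p≡1 : p ≡ 1ℤ
        p≡1 = ℤP.≤-antisym p≤1 1≤p
        tag≡1 : tag (reflect B v) ≡ 1ℤ
        tag≡1 = trans tag-sBv (trans (cong₂ _-_ D≡1+p (trans (solve 2 (λ p q → q := (q :+ p) :- p) refl p q′) (cong₂ _-_ q+p≡2 p≡1)))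
                                     (cong (λ t → 1ℤ + t - (+ 2 - 1ℤ)) p≡1))
      result : StepShape (reflect B v)
      result with sAv ≟ᵗ B
      ... | yes sAv≡B = sAv≡B⇒result sAv≡B
      ... | no  sAv≢B = sAv≢B⇒result sAv≢B

    result : StepShape (reflect B v)
    result with ≤2-cases c (ip-deg₁≤2 degA degB)
    ... | inj₁ c≡2                             = case2 c≡2
    ... | inj₂ (inj₁ c≡1)                      = Case1.result c≡1
    ... | inj₂ (inj₂ (inj₁ c≡0))               = Case0.result c≡0
    ... | inj₂ (inj₂ (inj₂ (inj₁ c≡-1)))       = Case-1.result c≡-1
    ... | inj₂ (inj₂ (inj₂ (inj₂ c≤-2)))       = ⊥-elim (ip-deg₁-pair-bound {v} {A} {B} valid bounded degA degB c≤-2 1≤p 1≤q)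

  -- (C, A) = tag x + 1 ≥ 2 for C = -s_A x, which forces C = A.
  reflect-negDeg₁⇒≡ : ∀ {x A} → Deg₁ (neg (reflect A x)) → Deg₁ A → 1ℤ ≤ tag x → x ≡ A
  reflect-negDeg₁⇒≡ {x} {A} degC degA 1≤tag = begin
    x                          ≡⟨ sym (reflect-involutive A normA x) ⟩
    reflect A y                ≡⟨ cong (reflect A) y≡-A ⟩
    reflect A (neg A)          ≡⟨ reflect-neg A A ⟩
    neg (reflect A A)          ≡⟨ cong neg (reflect-self A normA) ⟩
    neg (neg A)                ≡⟨ neg-involutive A ⟩
    A                          ∎
    where
    open ≡-Reasoning
    normA : ip A A ≡ + 2
    normA = Norm₂.norm degA
    y = reflect A x
    C = neg y
    tag-y : tag y ≡ - 1ℤ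
    tag-y = trans (sym (ℤP.neg-involutive (tag y))) (cong -_ (Norm₂.tag≡ degC))
    tag-x : tag x ≡ ip C A - 1ℤ
    tag-x = trans (cong tag (sym (reflect-involutive A normA x)))
      (trans (tag-reflect-deg₁ {y} degA)
        (trans (cong₂ _-_ tag-y (trans (sym (ℤP.neg-involutive _)) (cong -_ (sym (ip-neg y A)))))
               (solve 1 (λ c → :- con 1ℤ :- (:- c) := c :- con 1ℤ) refl (ip C A))))
    2≤CA : + 2 ≤ ip C A
    2≤CA = ≤-witness _ (trans (solve 1 (λ c → c :- con (+ 2) := (c :- con 1ℤ) :- con 1ℤ) refl (ip C A)) (cong (_- 1ℤ) (sym tag-x)))
                       (ℤP.i≤j⇒0≤j-i 1≤tag)
    y≡-A : y ≡ neg A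
    y≡-A = trans (sym (neg-involutive y)) (cong neg (ip-deg₁≡2⇒≡ degC degA (ℤP.≤-antisym (ip-deg₁≤2 degC degA) 2≤CA)))

  module _ {N : ℕ} (closed : ReflectionClosed N) {x A : Tagged n} (cand : Candidate x) (degA : Deg₁ A) where

    private
      valid : Valid x
      valid = proj₁ cand
      norm : ip x x ≡ + 2
      norm = proj₁ (proj₂ cand)
      normA : ip A A ≡ + 2
      normA = Norm₂.norm degA
      p = ip x A
      y = reflect A x
      valid-y : Valid y
      valid-y = valid-reflect {g = A} {x} (Norm₂.valid degA) valid
      norm-y : ip y y ≡ + 2
      norm-y = trans (reflect-isometry A normA x) norm

    -- s_A x stays bounded; its greedy step is a reflection in some B, handled by TwoReflections at y.
    reflect-up : p < 0ℤ → tag y ≤ + suc N → Candidate y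
    reflect-up p<0 tag≤ = valid-y , norm-y , greedy-y (≈-StepShape {reflect B y} {greedy y} (≈-sym {greedy y} {reflect B y} greedy≈) shape)
      where
      bounded-y : Bounded y
      bounded-y = bounded-reflect-up {x} {A} (Greedy-bounded (proj₂ (proj₂ cand))) degA (ℤP.<⇒≤ p<0)
      1≤-p : 1ℤ ≤ - p
      1≤-p = ≤-witness _ (solve 1 (λ p → :- p :- con 1ℤ := con 0ℤ :- (con 1ℤ :+ p)) refl p) (ℤP.i≤j⇒0≤j-i (ℤP.i<j⇒suc[i]≤j p<0))
      1≤tag-y : 1ℤ ≤ tag y
      1≤tag-y = subst (1ℤ ≤_) (sym (tag-reflect-deg₁ {x} degA))
        (ℤP.≤-trans (candidate-tag-positive {x} cand)
          (subst (_≤ tag x - p) (ℤP.+-identityʳ (tag x)) (ℤP.+-monoʳ-≤ (tag x) (ℤP.≤-trans (+≤+ z≤n) 1≤-p))))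
      B-data = greedy-as-reflection y
      B = proj₁ B-data
      degB : Deg₁ B
      degB = proj₁ (proj₂ B-data)
      greedy≈ : greedy y ≈ reflect B y
      greedy≈ = proj₁ (proj₂ (proj₂ B-data))
      1≤yB : 1ℤ ≤ ip y B
      1≤yB = subst (1ℤ ≤_) (sym (proj₂ (proj₂ (proj₂ B-data)))) (ip-dec-β-positive {y} valid-y bounded-y norm-y 1≤tag-y)
      1≤yA : 1ℤ ≤ ip y A
      1≤yA = subst (1ℤ ≤_) (sym (ip-reflect-self A normA x)) 1≤-p
      shape : StepShape (reflect B y)
      shape = TwoReflections.result closed {y} {A} {B} valid-y bounded-y norm-y tag≤ degA degB 1≤yA 1≤yB
                (subst Candidate (sym (reflect-involutive A normA x)) cand)
      greedy-y : StepShape (greedy y) → Greedy y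
      greedy-y (inj₁ cand′)         = step bounded-y (proj₂ (proj₂ cand′))
      greedy-y (inj₂ (inj₁ deg₀))   = ⊥-elim (greedy-not-deg₀ {y} valid-y norm-y 1≤tag-y deg₀)
      greedy-y (inj₂ (inj₂ negDeg₁)) = stop bounded-y (negDeg₁-nonpos {greedy y} negDeg₁)

    -- The greedy step of x is a reflection in some B, and TwoReflections at x (with A, B swapped) applies.
    reflect-down : 0ℤ < p → x ≢ A → tag x ≤ + suc N → Candidate y ⊎ Deg₀ y
    reflect-down 0<p x≢A tag≤ with proj₂ (proj₂ cand)
    ... | stop bounded stopped = inj₂ (norm₂ valid-y tag-y≡0 norm-y)
      where
      degx : Deg₁ x
      degx = norm₂ valid (greedy-stop⇒tag≡1 {x} valid bounded norm stopped) norm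
      p≡1 : p ≡ 1ℤ
      p≡1 = ℤP.≤-antisym (ℤP.i<j⇒i≤pred[j] (ℤP.≤∧≢⇒< (ip-deg₁≤2 degx degA) (λ p≡2 → x≢A (ip-deg₁≡2⇒≡ degx degA p≡2))))
                         (ℤP.i<j⇒suc[i]≤j 0<p)
      tag-y≡0 : tag y ≡ 0ℤ
      tag-y≡0 = trans (tag-reflect-deg₁ {x} degA) (cong₂ _-_ (Norm₂.tag≡ degx) p≡1)
    ... | step bounded greedy-next = fromShape shape
      where
      B-data = greedy-as-reflection x
      B = proj₁ B-data
      degB : Deg₁ B
      degB = proj₁ (proj₂ B-data)
      candB : Candidate (reflect B x)
      candB = ≈-Candidate {greedy x} {reflect B x} (proj₁ (proj₂ (proj₂ B-data)))
                (valid-greedy {x} valid , norm-greedy {x} norm , greedy-next)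
      1≤xB : 1ℤ ≤ ip x B
      1≤xB = subst (1ℤ ≤_) (sym (proj₂ (proj₂ (proj₂ B-data))))
               (ip-dec-β-positive {x} valid bounded norm (candidate-tag-positive {x} cand))
      shape : StepShape y
      shape = TwoReflections.result closed {x} {B} {A} valid bounded norm tag≤ degB degA 1≤xB (ℤP.i<j⇒suc[i]≤j 0<p) candB
      fromShape : StepShape y → Candidate y ⊎ Deg₀ y
      fromShape (inj₁ cand′)         = inj₁ cand′
      fromShape (inj₂ (inj₁ deg₀))   = inj₂ deg₀
      fromShape (inj₂ (inj₂ negDeg₁)) = ⊥-elim (x≢A (reflect-negDeg₁⇒≡ {x} {A} negDeg₁ degA (candidate-tag-positive {x} cand)))

  -- Induction on a bound for the degrees of x and s_A x.
  reflectionClosed : ∀ N → ReflectionClosed N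
  reflectionClosed zero    {x} cand _ _ tag≤0 _ = ⊥-elim (ℤP.<⇒≱ (+<+ (s≤s z≤n)) (ℤP.≤-trans (candidate-tag-positive {x} cand) tag≤0))
  reflectionClosed (suc N) {x} {A} cand degA x≢A tag-x≤ tag-y≤ with ℤP.<-cmp (ip x A) 0ℤ
  ... | tri< p<0 _ _ = inj₁ (reflect-up (reflectionClosed N) {x} {A} cand degA p<0 tag-y≤)
  ... | tri≈ _ p≡0 _ = inj₁ (subst Candidate (sym (trans (sub-cong p≡0 x A) (sub-zero x A))) cand)
  ... | tri> _ _ 0<p = reflect-down (reflectionClosed N) {x} {A} cand degA 0<p x≢A tag-x≤

  -- Real roots

  neg-RootShape : ∀ {u} → RootShape u → RootShape (neg u)
  neg-RootShape {u} (inj₁ cand)                         = inj₂ (inj₂ (subst Candidate (sym (neg-involutive u)) cand))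
  neg-RootShape {u} (inj₂ (inj₁ (norm₂ valid tag≡ norm))) =
    inj₂ (inj₁ (norm₂ (valid-neg {u = u} valid) (cong -_ tag≡) (trans (ip-neg-self u) norm)))
  neg-RootShape     (inj₂ (inj₂ cand))                  = inj₁ cand

  StepShape⇒RootShape : ∀ {u} → StepShape u → RootShape u
  StepShape⇒RootShape (inj₁ cand)           = inj₁ cand
  StepShape⇒RootShape (inj₂ (inj₁ deg₀))    = inj₂ (inj₁ deg₀)
  StepShape⇒RootShape (inj₂ (inj₂ negDeg₁)) = inj₂ (inj₂ (deg₁-candidate negDeg₁))

  reflectβ-candidate : ∀ {u} → Candidate u → RootShape (reflect β u)
  reflectβ-candidate {u} cand with u ≟ᵗ β
  ... | yes refl = inj₂ (inj₂ (subst Candidate (sym (trans (cong neg (reflect-self β β-norm)) (neg-involutive β)))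
                                      (deg₁-candidate β-deg₁)))
  ... | no  u≢β with reflectionClosed N cand β-deg₁ u≢β (i≤N (tag u) (ℕP.m≤m+n _ _)) (i≤N (tag (reflect β u)) (ℕP.m≤n+m _ _))
    where
    N = ℤ.∣ tag u ∣ ℕ.+ ℤ.∣ tag (reflect β u) ∣
    i≤N : ∀ i → ℤ.∣ i ∣ ℕ.≤ N → i ≤ + N
    i≤N (+ _)      ∣i∣≤N = +≤+ ∣i∣≤N
    i≤N -[1+ _ ]   _     = -≤+
  ...   | inj₁ cand′ = inj₁ cand′
  ...   | inj₂ deg₀  = inj₂ (inj₁ deg₀)

  RootShape-reflectβ : ∀ {u} → RootShape u → RootShape (reflect β u)
  RootShape-reflectβ     (inj₁ cand)        = reflectβ-candidate cand
  RootShape-reflectβ {u} (inj₂ (inj₁ deg₀)) = StepShape⇒RootShape (deg₀-step {u} {β} deg₀ β-deg₁)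
  RootShape-reflectβ {u} (inj₂ (inj₂ cand)) =
    subst RootShape (trans (cong neg (reflect-neg β u)) (neg-involutive (reflect β u)))
      (neg-RootShape {reflect β (neg u)} (reflectβ-candidate cand))

  realRoot-RootShape : ∀ (w : List (Gen n)) →
    Σ ℤ λ d → Valid (actWord k w (betaV k n) , d) × RootShape (actWord k w (betaV k n) , d)
  realRoot-RootShape []      = 1ℤ , subst (λ b → Valid (b , 1ℤ)) (sym (betaV≡ones k n)) (Norm₂.valid β-deg₁)
                                  , subst (λ b → RootShape (b , 1ℤ)) (sym (betaV≡ones k n)) (inj₁ (deg₁-candidate β-deg₁))
  realRoot-RootShape (genβ ∷ w) with realRoot-RootShape w
  ... | d , valid , shape = tag (reflect β (x , d))
                          , subst (λ t → Valid (t , tag (reflect β (x , d)))) (sym sβx≡)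
                              (valid-reflect {g = β} {x , d} (Norm₂.valid β-deg₁) valid)
                          , subst (λ t → RootShape (t , tag (reflect β (x , d)))) (sym sβx≡) (RootShape-reflectβ shape)
    where
    x = actWord k w (betaV k n)
    sβx≡ : sβ k x ≡ vec (reflect β (x , d))
    sβx≡ = sβ≡reflect x d valid
  realRoot-RootShape (genα i _ ∷ w) with realRoot-RootShape w
  ... | d , valid , shape = d , trans (sumℤ-resp-↭ (swapAt-↭ i x)) valid
                              , ≈-RootShape {x , d} {swapAt i x , d} (↭-sym (swapAt-↭ i x) , refl) shape
    where
    x = actWord k w (betaV k n)

  sβ-dec≡greedy : ∀ {u} → Valid u → sβ k (dec (vec u)) ≡ vec (greedy u)
  sβ-dec≡greedy {x , d} valid = sβ≡reflect (dec x) d (valid-dec {x} valid)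

  iter-greedy : ∀ {u} → Valid u → ∀ i → iter k (suc i) (vec u) ≡ iter k i (vec (greedy u))
  iter-greedy {u} valid i = trans (iter-suc i (vec u)) (cong (iter k i) (sβ-dec≡greedy {u} valid))
    where
    iter-suc : ∀ i (x : Vec ℤ n) → iter k (suc i) x ≡ iter k i (sβ k (dec x))
    iter-suc zero    x = refl
    iter-suc (suc i) x = cong (λ t → sβ k (dec t)) (iter-suc i x)

  Bounded⇔Prop1 : ∀ {u} → Valid u → (Bounded u → Prop1 k (vec u)) × (Prop1 k (vec u) → Bounded u)
  Bounded⇔Prop1 {x , d} valid = subst (λ t → All (λ a → (0ℤ ≤ a) × (a ≤ t)) x) (sym (deg≡ x d valid))
                              , subst (λ t → All (λ a → (0ℤ ≤ a) × (a ≤ t)) x) (deg≡ x d valid)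

  Greedy⇒Prop3 : ∀ {u} → Valid u → Greedy u → Prop3 k (vec u)
  Greedy⇒Prop3 {u} valid (stop bounded stopped) =
    0 , (λ { .zero z≤n → proj₁ (Bounded⇔Prop1 {u} valid) bounded }) , subst (All (_≤ 0ℤ)) (sym (sβ-dec≡greedy {u} valid)) stopped
  Greedy⇒Prop3 {u} valid (step bounded next) with Greedy⇒Prop3 {greedy u} (valid-greedy {u} valid) next
  ... | m , prop1 , last = suc m , prop1′ , subst (All (_≤ 0ℤ)) (sym (iter-greedy {u} valid (suc m))) last
    where
    prop1′ : ∀ i → i ℕ.≤ suc m → Prop1 k (iter k i (vec u))
    prop1′ zero    _         = proj₁ (Bounded⇔Prop1 {u} valid) bounded
    prop1′ (suc i) (s≤s i≤m) = subst (Prop1 k) (sym (iter-greedy {u} valid i)) (prop1 i i≤m)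

  Prop3⇒Greedy : ∀ m {u} → Valid u → (∀ i → i ℕ.≤ m → Prop1 k (iter k i (vec u))) →
                 All (_≤ 0ℤ) (iter k (suc m) (vec u)) → Greedy u
  Prop3⇒Greedy zero    {u} valid prop1 last =
    stop (proj₂ (Bounded⇔Prop1 {u} valid) (prop1 0 z≤n)) (subst (All (_≤ 0ℤ)) (sβ-dec≡greedy {u} valid) last)
  Prop3⇒Greedy (suc m) {u} valid prop1 last =
    step (proj₂ (Bounded⇔Prop1 {u} valid) (prop1 0 z≤n))
      (Prop3⇒Greedy m {greedy u} (valid-greedy {u} valid)
        (λ i i≤m → subst (Prop1 k) (iter-greedy {u} valid i) (prop1 (suc i) (s≤s i≤m)))
        (subst (All (_≤ 0ℤ)) (iter-greedy {u} valid (suc m)) last))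

  realRoot-resp-↭ : ∀ {x y} → IsRealRoot k n x → x ↭ y → IsRealRoot k n y
  realRoot-resp-↭ {x} (w , w≡) p with ↭⇒swaps p
  ... | ws , ws≡ = gens ws ++ w , trans (actWord-++ (gens ws) w (betaV k n))
                                            (trans (actWord-gens ws _) (trans (cong (applySwaps ws) w≡) ws≡))
    where
    gens : List (Swap n) → List (Gen n)
    gens = List.map (λ s → genα (proj₁ s) (proj₂ s))
    actWord-gens : ∀ ws x → actWord k (gens ws) x ≡ applySwaps ws x
    actWord-gens []             x = refl
    actWord-gens ((i , _) ∷ ws) x = cong (swapAt i) (actWord-gens ws x)
    actWord-++ : ∀ ws vs x → actWord k (ws ++ vs) x ≡ actWord k ws (actWord k vs x)
    actWord-++ []       vs x = refl
    actWord-++ (g ∷ ws) vs x = cong (act k g) (actWord-++ ws vs x)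

  -- Running the greedy sequence backwards writes x as a word applied to β.
  greedy⇒realRoot : ∀ {u} → Valid u → ip u u ≡ + 2 → Greedy u → IsRealRoot k n (vec u)
  greedy⇒realRoot {x , d} valid norm (stop bounded stopped) = realRoot-resp-↭ ([] , β≡dec) (dec-↭ x)
    where
    deg₁ : Deg₁ (x , d)
    deg₁ = norm₂ valid (greedy-stop⇒tag≡1 {x , d} valid bounded norm stopped) norm
    β≡dec : betaV k n ≡ dec x
    β≡dec = trans (betaV≡ones k n) (sym (deg₁-dec≡ones {x , d} deg₁))
  greedy⇒realRoot {x , d} valid norm (step _ next) = realRoot-resp-↭ (genβ ∷ proj₁ root , sβ≡dec) (dec-↭ x)
    where
    g = greedy (x , d)
    root : IsRealRoot k n (vec g)
    root = greedy⇒realRoot {g} (valid-greedy {x , d} valid) (norm-greedy {x , d} norm) next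
    sβg≡ : sβ k (vec g) ≡ vec (reflect β g)
    sβg≡ = sβ≡reflect (vec g) (tag g) (valid-greedy {x , d} valid)
    β-g≡ : vec (reflect β g) ≡ dec x
    β-g≡ = cong vec (reflect-involutive β β-norm (dec x , d))
    sβ≡dec : sβ k (actWord k (proj₁ root) (betaV k n)) ≡ dec x
    sβ≡dec = trans (cong (sβ k) (proj₂ root)) (trans sβg≡ β-g≡)

  candidate⇒properties : ∀ {x d} → Candidate (x , d) → Prop1 k x × (q k x ≡ + 2) × Prop3 k x
  candidate⇒properties {x} {d} (valid , norm , greedy-x) =
    proj₁ (Bounded⇔Prop1 {x , d} valid) (Greedy-bounded greedy-x) , trans (q≡ip x d valid) norm , Greedy⇒Prop3 {x , d} valid greedy-x

  positive-realRoot⇒properties : ∀ x → IsRealRoot k n x → 1ℤ ≤ deg k x → Prop1 k x × (q k x ≡ + 2) × Prop3 k x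
  positive-realRoot⇒properties x (w , w≡) 1≤deg with realRoot-RootShape w
  ... | d , valid , shape = fromShape (subst (λ t → RootShape (t , d)) w≡ shape)
    where
    valid′ : Valid (x , d)
    valid′ = subst (λ t → Valid (t , d)) w≡ valid
    1≤d : 1ℤ ≤ d
    1≤d = subst (1ℤ ≤_) (deg≡ x d valid′) 1≤deg
    fromShape : RootShape (x , d) → Prop1 k x × (q k x ≡ + 2) × Prop3 k x
    fromShape (inj₁ cand)                      = candidate⇒properties cand
    fromShape (inj₂ (inj₁ (norm₂ _ d≡0 _)))    = ⊥-elim (ℤP.<⇒≱ (+<+ (s≤s z≤n)) (subst (1ℤ ≤_) d≡0 1≤d))
    fromShape (inj₂ (inj₂ cand))               =
      ⊥-elim (ℤP.<⇒≱ (+<+ (s≤s z≤n)) (ℤP.≤-trans (ℤP.+-mono-≤ 1≤d (candidate-tag-positive {neg (x , d)} cand))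
                                                 (ℤP.≤-reflexive (ℤP.+-inverseʳ d))))

  properties⇒positive-realRoot : ∀ x d → Valid (x , d) → Prop1 k x × (q k x ≡ + 2) × Prop3 k x →
                                 IsRealRoot k n x × IsPositive k n x × (1ℤ ≤ deg k x)
  properties⇒positive-realRoot x d valid (_ , q≡2 , m , prop1 , last) =
    greedy⇒realRoot {x , d} valid norm greedy-x ,
    bounded⇒positive k n x d (bounded-tag-nonneg {x , d} bounded) bounded valid k≤n (ℕP.≤-trans 1≤k k≤n) ,
    subst (1ℤ ≤_) (sym (deg≡ x d valid)) (candidate-tag-positive {x , d} (valid , norm , greedy-x))
    where
    norm : ip (x , d) (x , d) ≡ + 2
    norm = trans (sym (q≡ip x d valid)) q≡2
    greedy-x : Greedy (x , d)
    greedy-x = Prop3⇒Greedy m {x , d} valid prop1 last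
    bounded : Bounded (x , d)
    bounded = Greedy-bounded greedy-x

theorem1p1 : (k n : ℕ) → 1 ℕ.≤ k → k ℕ.< n → (x : Vec ℤ n) → InZΔ k x →
    ((IsRealRoot k n x × IsPositive k n x × (1ℤ ≤ deg k x))
    ⇔ (Prop1 k x × (q k x ≡ + 2) × Prop3 k x))
theorem1p1 k n 1≤k k<n x x∈ZΔ with InZΔ⇒degree k x x∈ZΔ
... | d , valid = mk⇔ (λ (root , _ , 1≤deg) → positive-realRoot⇒properties x root 1≤deg)
                      (properties⇒positive-realRoot x d valid)
  where open RootSystem k n 1≤k k<n
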